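{- In $\mathsf{RSLR}$, let $\Gamma;\Delta\vdash t:A$. Then: (1) if $\Gamma=x:\blacksquare\mathbf{N},\Theta$, then $\Theta;\Delta\vdash t[x:=n]:A$ for every numeral $n$; (2) if $\Delta=x:\blacksquare H,\Theta$ with $H$ a type different from $\mathbf{N}$, and $\Gamma;\Xi\vdash s:H$, then $\Gamma;\Theta,\Xi\vdash t[x:=s]:A$.
   Context: $\mathsf{RSLR}$ types: $A::=\mathbf{N}\mid aA\rightarrow A$ with aspects $a\in\{\square,\blacksquare\}$ ordered by $\square<:\square$, $\square<:\blacksquare$, $\blacksquare<:\blacksquare$; subtyping is the least reflexive transitive relation with $aA\rightarrow C<:bB\rightarrow D$ when $B<:A$, $C<:D$, $b<:a$; a type is $\square$-free if $\square$ does not occur in it. Terms: $t::=x\mid c\mid ts\mid\lambda x:aA.t\mid\mathtt{case}_A\,t\ \mathtt{zero}\ s\ \mathtt{even}\ r\ \mathtt{odd}\ q\mid\mathtt{recursion}_A\,t\,s\,r$, constants $c::=n\mid S_0\mid S_1\mid P\mid\mathtt{rand}$ (numerals $n$), typed $n,\mathtt{rand}:\mathbf{N}$, $S_0,S_1,P:\blacksquare\mathbf{N}\rightarrow\mathbf{N}$; $t[x:=s]$ is capture-avoiding substitution. A context is a finite set of assignments $x:aA$ with distinct variables; $\Gamma,\Delta$ is disjoint union, written $\Gamma;\Delta$ when all types in $\Gamma$ are $\mathbf{N}$; $\Gamma<:a$ means all aspects in $\Gamma$ are $<:a$. Typing rules: $\Gamma\vdash x:A$ if $x:aA\in\Gamma$;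 from $\Gamma\vdash t:A$, $A<:B$ infer $\Gamma\vdash t:B$; from $\Gamma,x:aA\vdash t:B$ infer $\Gamma\vdash\lambda x:aA.t:aA\rightarrow B$; $\Gamma\vdash c:\mathrm{type}(c)$; from $\Gamma;\Delta_1\vdash t:\mathbf{N}$, $\Gamma;\Delta_2\vdash s:A$, $\Gamma;\Delta_3\vdash r:A$, $\Gamma;\Delta_4\vdash q:A$, $A$ $\square$-free, infer $\Gamma;\Delta_1,\Delta_2,\Delta_3,\Delta_4\vdash\mathtt{case}_A\,t\ \mathtt{zero}\ s\ \mathtt{even}\ r\ \mathtt{odd}\ q:A$; from $\Gamma_1;\Delta_1\vdash t:\mathbf{N}$, $\Gamma_1,\Gamma_2;\Delta_2\vdash s:A$, $\Gamma_1,\Gamma_2;\emptyset\vdash r:\square\mathbf{N}\rightarrow\blacksquare A\rightarrow A$, $\Gamma_1,\Delta_1<:\square$, $A$ $\square$-free, infer $\Gamma_1,\Gamma_2;\Delta_1,\Delta_2\vdash\mathtt{recursion}_A\,t\,s\,r:A$; from $\Gamma;\Delta_1\vdash t:aA\rightarrow B$, $\Gamma;\Delta_2\vdash s:A$, $\Gamma,\Delta_2<:a$ infer $\Gamma;\Delta_1,\Delta_2\vdash ts:B$. -}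

module Defs where

open import Data.Nat using (ℕ; zero; suc; _≟_)
open import Data.List using (List; []; _∷_; _++_; map)
open import Data.List.Membership.Propositional using (_∈_; _∉_)
open import Data.List.Relation.Unary.All using (All)
open import Data.List.Relation.Unary.Unique.Propositional using (Unique)
open import Data.List.Relation.Binary.Permutation.Propositional using (_↭_)
open import Relation.Binary.PropositionalEquality using (_≡_)
open import Relation.Nullary using (yes; no)

data Aspect : Set where
  □ ■ : Aspect

data _≤ₐ_ : Aspect → Aspect → Set where
  □≤□ : □ ≤ₐ □
  □≤■ : □ ≤ₐ ■
  ■≤■ : ■ ≤ₐ ■

infixr 5 _▹_⇒_
data Type : Set where
  N     : Type
  _▹_⇒_ : Aspect → Type → Type → Type

data _<:_ : Type → Type → Set where
  <:-refl  : ∀ {A} → A <: A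
  <:-trans : ∀ {A B C} → A <: B → B <: C → A <: C
  <:-arr   : ∀ {a b A B C D} → B <: A → C <: D → b ≤ₐ a →
             (a ▹ A ⇒ C) <: (b ▹ B ⇒ D)

data BoxFree : Type → Set where
  N-free   : BoxFree N
  arr-free : ∀ {A B} → BoxFree A → BoxFree B → BoxFree (■ ▹ A ⇒ B)

-- Terms (locally nameless: bound variables are de Bruijn indices,
-- free variables are names; terms are thus identified up to α)

Name : Set
Name = ℕ

data Const : Set where
  num  : ℕ → Const
  S₀ S₁ P rand : Const

typeOf : Const → Type
typeOf (num _) = N
typeOf rand    = N
typeOf S₀      = ■ ▹ N ⇒ N
typeOf S₁      = ■ ▹ N ⇒ N
typeOf P       = ■ ▹ N ⇒ N

data Term : Set where
  bvar      : ℕ → Term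
  fvar      : Name → Term
  const     : Const → Term
  app       : Term → Term → Term
  lam       : Aspect → Type → Term → Term
  case      : Type → Term → Term → Term → Term → Term   -- case_A t zero s even r odd q
  recursion : Type → Term → Term → Term → Term

openAt : ℕ → Term → Term → Term
openAt k u (bvar i) with k ≟ i
... | yes _ = u
... | no  _ = bvar i
openAt k u (fvar y)            = fvar y
openAt k u (const c)           = const c
openAt k u (app t s)           = app (openAt k u t) (openAt k u s)
openAt k u (lam a A t)         = lam a A (openAt (suc k) u t)
openAt k u (case A t s r q)    = case A (openAt k u t) (openAt k u s) (openAt k u r) (openAt k u q)
openAt k u (recursion A t s r) = recursion A (openAt k u t) (openAt k u s) (openAt k u r)

open-var : Term → Name → Term
open-var t x = openAt 0 (fvar x) t

fv : Term → List Name
fv (bvar _)            = []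
fv (fvar y)            = y ∷ []
fv (const _)           = []
fv (app t s)           = fv t ++ fv s
fv (lam _ _ t)         = fv t
fv (case _ t s r q)    = fv t ++ fv s ++ fv r ++ fv q
fv (recursion _ t s r) = fv t ++ fv s ++ fv r

-- substitution t[x:=s] of a free variable (capture-avoiding by construction)
_[_≔_] : Term → Name → Term → Term
bvar i [ x ≔ s ] = bvar i
fvar y [ x ≔ s ] with x ≟ y
... | yes _ = s
... | no  _ = fvar y
const c [ x ≔ s ]             = const c
app t u [ x ≔ s ]             = app (t [ x ≔ s ]) (u [ x ≔ s ])
lam a A t [ x ≔ s ]           = lam a A (t [ x ≔ s ])
case A t u r q [ x ≔ s ]      = case A (t [ x ≔ s ]) (u [ x ≔ s ]) (r [ x ≔ s ]) (q [ x ≔ s ])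
recursion A t u r [ x ≔ s ]   = recursion A (t [ x ≔ s ]) (u [ x ≔ s ]) (r [ x ≔ s ])

-- Contexts: lists of assignments x : aA; as sets up to permutation,
-- required to have distinct variables.

record Decl : Set where
  constructor _∶[_]_
  field
    nm  : Name
    asp : Aspect
    ty  : Type
open Decl public

Ctx : Set
Ctx = List Decl

Valid : Ctx → Set
Valid Γ = Unique (map nm Γ)

AllN : Ctx → Set
AllN Γ = All (λ d → ty d ≡ N) Γ

_<:ₐ_ : Ctx → Aspect → Set
Γ <:ₐ a = All (λ d → asp d ≤ₐ a) Γ

-- Typing.  A judgement  Γ;Δ ⊢ t : A  is the judgement  (Γ ++ Δ) ⊢ t ∶ A
-- with AllN Γ.  Disjoint union of contexts is concatenation (up to
-- permutation, with distinct variables).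

infix 4 _⊢_∶_
data _⊢_∶_ : Ctx → Term → Type → Set where
  ty-var   : ∀ {Γ x a A} → Valid Γ → (x ∶[ a ] A) ∈ Γ → Γ ⊢ fvar x ∶ A
  ty-sub   : ∀ {Γ t A B} → Γ ⊢ t ∶ A → A <: B → Γ ⊢ t ∶ B
  ty-lam   : ∀ {Γ t a A B} (x : Name) → x ∉ fv t →
             ((x ∶[ a ] A) ∷ Γ) ⊢ open-var t x ∶ B →
             Γ ⊢ lam a A t ∶ (a ▹ A ⇒ B)
  ty-const : ∀ {Γ c} → Valid Γ → Γ ⊢ const c ∶ typeOf c
  ty-case  : ∀ {Ξ Γ Δ₁ Δ₂ Δ₃ Δ₄ t s r q A} →
             AllN Γ → BoxFree A →
             Ξ ↭ (Γ ++ Δ₁ ++ Δ₂ ++ Δ₃ ++ Δ₄) → Valid Ξ →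
             (Γ ++ Δ₁) ⊢ t ∶ N → (Γ ++ Δ₂) ⊢ s ∶ A →
             (Γ ++ Δ₃) ⊢ r ∶ A → (Γ ++ Δ₄) ⊢ q ∶ A →
             Ξ ⊢ case A t s r q ∶ A
  ty-rec   : ∀ {Ξ Γ₁ Γ₂ Δ₁ Δ₂ t s r A} →
             AllN (Γ₁ ++ Γ₂) → BoxFree A → (Γ₁ ++ Δ₁) <:ₐ □ →
             Ξ ↭ ((Γ₁ ++ Γ₂) ++ (Δ₁ ++ Δ₂)) → Valid Ξ →
             (Γ₁ ++ Δ₁) ⊢ t ∶ N →
             ((Γ₁ ++ Γ₂) ++ Δ₂) ⊢ s ∶ A →
             ((Γ₁ ++ Γ₂) ++ []) ⊢ r ∶ (□ ▹ N ⇒ ■ ▹ A ⇒ A) →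
             Ξ ⊢ recursion A t s r ∶ A
  ty-app   : ∀ {Ξ Γ Δ₁ Δ₂ t s a A B} →
             AllN Γ → (Γ ++ Δ₂) <:ₐ a →
             Ξ ↭ (Γ ++ Δ₁ ++ Δ₂) → Valid Ξ →
             (Γ ++ Δ₁) ⊢ t ∶ (a ▹ A ⇒ B) → (Γ ++ Δ₂) ⊢ s ∶ A →
             Ξ ⊢ app t s ∶ B

-- A numeral is typed in every context, so substituting it for x only deletes the declaration of x (part 1).
--
-- For part 2 the difficulty is the mixture of sharing and linearity: the N-part of a case, recursion or
-- application is shared by all premises, while the linear part is split among them. We prove the statement for a
-- derivation of t in an arbitrary context M in which x can only be declared as ■H: then t[x:=s] is typed in
-- Γ, (M without x and Γ), E, where E is any extra linear context that contains Ξ whenever x occurs in M. Since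
-- H ≠ N, x never lies in the shared part of a premise, so Ξ can be handed to the one premise that contains x.
-- The rules that restrict aspects to □ (the argument of a □-application, the recursion argument) cannot contain
-- the ■-variable x; the declarations of Γ that they use are N-declarations of aspect □, and these are moved into
-- the shared part, where the premise containing s finds them too.
--
-- Binders are renamed apart by the renaming lemma; as a renamed derivation is not a subderivation, the inductions
-- that need renaming are on the depth of the term, which renaming preserves.

module Submission where

open import Defs
open import Data.Nat using (ℕ; suc; _≟_; _≤_; _<_; _⊔_; z≤n; s≤s)
open import Data.Nat.Properties using (≤-refl; ≤-trans; n≤1+n; 1+n≰n; <⇒≱; m⊔n≤o⇒m≤o; m⊔n≤o⇒n≤o)
open import Data.List using (List; []; _∷_; _++_; map; filter)
open import Data.List.Properties
  using (map-++; map-∘; map-id-local; filter-++; filter-accept; filter-reject; filter-all; filter-none; ++-assoc)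
open import Data.List.Extrema.Nat using (max; xs≤max)
open import Data.List.Membership.Propositional using (_∈_; _∉_)
open import Data.List.Membership.Propositional.Properties
  using (∈-map⁺; ∈-map⁻; ∈-++⁺ˡ; ∈-++⁺ʳ; ∈-++⁻; ∈-filter⁺; ∈-filter⁻)
open import Data.List.Membership.Propositional.Properties.WithK using (unique∧set⇒bag)
open import Data.List.Membership.DecPropositional _≟_ using (_∈?_; _∉?_)
open import Data.List.Relation.Unary.Any using (here; there)
open import Data.List.Relation.Unary.All as All using (All; []; _∷_)
import Data.List.Relation.Unary.All.Properties as All
open import Data.List.Relation.Unary.AllPairs using ([]; _∷_)
import Data.List.Relation.Unary.AllPairs.Properties as AllPairs
open import Data.List.Relation.Unary.Unique.Propositional using (Unique)
import Data.List.Relation.Unary.Unique.Propositional.Properties as Unique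
open import Data.List.Relation.Binary.Subset.Propositional using (_⊆_)
import Data.List.Relation.Binary.Subset.Propositional.Properties as ⊆
open import Data.List.Relation.Binary.Permutation.Propositional
  using (_↭_; ↭-refl; ↭-sym; ↭-trans; ↭-prep; ↭-swap; ↭-reflexive; ↭⇒↭ₛ)
import Data.List.Relation.Binary.Permutation.Propositional.Properties as ↭
open import Data.List.Relation.Binary.Permutation.Setoid.Properties using (Unique-resp-↭)
open import Data.List.Relation.Binary.BagAndSetEquality using (∼bag⇒↭)
open import Algebra.Solver.CommutativeMonoid (↭.++-commutativeMonoid {A = Decl})
  using (solve; _⊕_; _⊜_) renaming (id to ε)
open import Data.Empty using (⊥-elim)
open import Data.Product using (∃; ∃₂; _×_; _,_; proj₁; proj₂)
open import Data.Sum using (_⊎_; inj₁; inj₂; [_,_]′)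
open import Function using (_∘_; mk⇔)
open import Function.Definitions using (Injective)
open import Relation.Unary using (Decidable)
open import Relation.Nullary using (yes; no)
open import Relation.Binary.PropositionalEquality
  using (_≡_; _≢_; refl; sym; trans; cong; cong₂; subst; subst₂; setoid; module ≡-Reasoning)

-- Names, substitution and local closure of terms

cong₃ : ∀ {A B C D : Set} (f : A → B → C → D) {a a' b b' c c'} →
        a ≡ a' → b ≡ b' → c ≡ c' → f a b c ≡ f a' b' c'
cong₃ f refl refl refl = refl

cong₄ : ∀ {A B C D E : Set} (f : A → B → C → D → E) {a a' b b' c c' d d'} →
        a ≡ a' → b ≡ b' → c ≡ c' → d ≡ d' → f a b c d ≡ f a' b' c' d'
cong₄ f refl refl refl refl = refl

fresh : List Name → Name
fresh xs = suc (max 0 xs)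

fresh-∉ : ∀ xs → fresh xs ∉ xs
fresh-∉ xs p = 1+n≰n (All.lookup (xs≤max 0 xs) p)

swap : Name → Name → Name → Name
swap y w z with z ≟ y
... | yes _ = w
... | no  _ with z ≟ w
...   | yes _ = y
...   | no  _ = z

swap-left : ∀ y w → swap y w y ≡ w
swap-left y w with y ≟ y
... | yes _   = refl
... | no  y≢y = ⊥-elim (y≢y refl)

swap-right : ∀ y w → swap y w w ≡ y
swap-right y w with w ≟ y
... | yes w≡y = w≡y
... | no  _ with w ≟ w
...   | yes _   = refl
...   | no  w≢w = ⊥-elim (w≢w refl)

swap-other : ∀ {y w z} → z ≢ y → z ≢ w → swap y w z ≡ z
swap-other {y} {w} {z} z≢y z≢w with z ≟ y
... | yes z≡y = ⊥-elim (z≢y z≡y)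
... | no  _ with z ≟ w
...   | yes z≡w = ⊥-elim (z≢w z≡w)
...   | no  _   = refl

swap-involutive : ∀ y w z → swap y w (swap y w z) ≡ z
swap-involutive y w z with z ≟ y
... | yes refl = swap-right z w
... | no  z≢y with z ≟ w
...   | yes refl = swap-left y z
...   | no  z≢w  = swap-other z≢y z≢w

swap-injective : ∀ y w → Injective _≡_ _≡_ (swap y w)
swap-injective y w {z} {z′} eq =
  trans (sym (swap-involutive y w z)) (trans (cong (swap y w) eq) (swap-involutive y w z′))

_⟪_⟫ : Term → (Name → Term) → Term
bvar i              ⟪ σ ⟫ = bvar i
fvar y              ⟪ σ ⟫ = σ y
const c             ⟪ σ ⟫ = const c
app t u             ⟪ σ ⟫ = app (t ⟪ σ ⟫) (u ⟪ σ ⟫)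
lam a A t           ⟪ σ ⟫ = lam a A (t ⟪ σ ⟫)
case A t u r q      ⟪ σ ⟫ = case A (t ⟪ σ ⟫) (u ⟪ σ ⟫) (r ⟪ σ ⟫) (q ⟪ σ ⟫)
recursion A t u r   ⟪ σ ⟫ = recursion A (t ⟪ σ ⟫) (u ⟪ σ ⟫) (r ⟪ σ ⟫)

_↦_ : Name → Term → Name → Term
(x ↦ s) y with x ≟ y
... | yes _ = s
... | no  _ = fvar y

rename : (Name → Name) → Term → Term
rename f t = t ⟪ fvar ∘ f ⟫

[≔]-≡-⟪↦⟫ : ∀ t x s → t [ x ≔ s ] ≡ t ⟪ x ↦ s ⟫
[≔]-≡-⟪↦⟫ (bvar i) x s = refl
[≔]-≡-⟪↦⟫ (fvar y) x s with x ≟ y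
... | yes _ = refl
... | no  _ = refl
[≔]-≡-⟪↦⟫ (const c) x s = refl
[≔]-≡-⟪↦⟫ (app t u) x s = cong₂ app ([≔]-≡-⟪↦⟫ t x s) ([≔]-≡-⟪↦⟫ u x s)
[≔]-≡-⟪↦⟫ (lam a A t) x s = cong (lam a A) ([≔]-≡-⟪↦⟫ t x s)
[≔]-≡-⟪↦⟫ (case A t u r q) x s =
  cong₄ (case A) ([≔]-≡-⟪↦⟫ t x s) ([≔]-≡-⟪↦⟫ u x s) ([≔]-≡-⟪↦⟫ r x s) ([≔]-≡-⟪↦⟫ q x s)
[≔]-≡-⟪↦⟫ (recursion A t u r) x s =
  cong₃ (recursion A) ([≔]-≡-⟪↦⟫ t x s) ([≔]-≡-⟪↦⟫ u x s) ([≔]-≡-⟪↦⟫ r x s)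

data LC : ℕ → Term → Set where
  lc-bvar      : ∀ {k i} → i < k → LC k (bvar i)
  lc-fvar      : ∀ {k y} → LC k (fvar y)
  lc-const     : ∀ {k c} → LC k (const c)
  lc-app       : ∀ {k t u} → LC k t → LC k u → LC k (app t u)
  lc-lam       : ∀ {k a A t} → LC (suc k) t → LC k (lam a A t)
  lc-case      : ∀ {k A t u r q} → LC k t → LC k u → LC k r → LC k q → LC k (case A t u r q)
  lc-recursion : ∀ {k A t u r} → LC k t → LC k u → LC k r → LC k (recursion A t u r)

LC-openAt⁻ : ∀ k y t → LC k (openAt k (fvar y) t) → LC (suc k) t
LC-openAt⁻ k y (bvar i) h with k ≟ i
LC-openAt⁻ k y (bvar i) h           | yes refl = lc-bvar ≤-refl
LC-openAt⁻ k y (bvar i) (lc-bvar p) | no _     = lc-bvar (≤-trans p (n≤1+n k))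
LC-openAt⁻ k y (fvar z) h = lc-fvar
LC-openAt⁻ k y (const c) h = lc-const
LC-openAt⁻ k y (app t u) (lc-app ht hu) = lc-app (LC-openAt⁻ k y t ht) (LC-openAt⁻ k y u hu)
LC-openAt⁻ k y (lam a A t) (lc-lam ht) = lc-lam (LC-openAt⁻ (suc k) y t ht)
LC-openAt⁻ k y (case A t u r q) (lc-case ht hu hr hq) =
  lc-case (LC-openAt⁻ k y t ht) (LC-openAt⁻ k y u hu) (LC-openAt⁻ k y r hr) (LC-openAt⁻ k y q hq)
LC-openAt⁻ k y (recursion A t u r) (lc-recursion ht hu hr) =
  lc-recursion (LC-openAt⁻ k y t ht) (LC-openAt⁻ k y u hu) (LC-openAt⁻ k y r hr)

openAt-LC : ∀ {k j u t} → LC k t → k ≤ j → openAt j u t ≡ t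
openAt-LC {j = j} {t = bvar i} (lc-bvar i<k) k≤j with j ≟ i
... | yes refl = ⊥-elim (<⇒≱ i<k k≤j)
... | no _ = refl
openAt-LC lc-fvar _ = refl
openAt-LC lc-const _ = refl
openAt-LC (lc-app ht hu) k≤j = cong₂ app (openAt-LC ht k≤j) (openAt-LC hu k≤j)
openAt-LC (lc-lam ht) k≤j = cong (lam _ _) (openAt-LC ht (s≤s k≤j))
openAt-LC (lc-case ht hu hr hq) k≤j =
  cong₄ (case _) (openAt-LC ht k≤j) (openAt-LC hu k≤j) (openAt-LC hr k≤j) (openAt-LC hq k≤j)
openAt-LC (lc-recursion ht hu hr) k≤j =
  cong₃ (recursion _) (openAt-LC ht k≤j) (openAt-LC hu k≤j) (openAt-LC hr k≤j)

⟪⟫-openAt : ∀ {σ} → (∀ y → LC 0 (σ y)) → ∀ k u t →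
            openAt k u t ⟪ σ ⟫ ≡ openAt k (u ⟪ σ ⟫) (t ⟪ σ ⟫)
⟪⟫-openAt lcσ k u (bvar i) with k ≟ i
... | yes _ = refl
... | no  _ = refl
⟪⟫-openAt lcσ k u (fvar y) = sym (openAt-LC (lcσ y) z≤n)
⟪⟫-openAt lcσ k u (const c) = refl
⟪⟫-openAt lcσ k u (app t v) = cong₂ app (⟪⟫-openAt lcσ k u t) (⟪⟫-openAt lcσ k u v)
⟪⟫-openAt lcσ k u (lam a A t) = cong (lam a A) (⟪⟫-openAt lcσ (suc k) u t)
⟪⟫-openAt lcσ k u (case A t v r q) =
  cong₄ (case A) (⟪⟫-openAt lcσ k u t) (⟪⟫-openAt lcσ k u v) (⟪⟫-openAt lcσ k u r) (⟪⟫-openAt lcσ k u q)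
⟪⟫-openAt lcσ k u (recursion A t v r) =
  cong₃ (recursion A) (⟪⟫-openAt lcσ k u t) (⟪⟫-openAt lcσ k u v) (⟪⟫-openAt lcσ k u r)

⟪⟫-identity : ∀ {σ} t → All (λ y → σ y ≡ fvar y) (fv t) → t ⟪ σ ⟫ ≡ t
⟪⟫-identity (bvar i) _ = refl
⟪⟫-identity (fvar y) (σy ∷ []) = σy
⟪⟫-identity (const c) _ = refl
⟪⟫-identity (app t u) h =
  let ht , hu = All.++⁻ (fv t) h in
  cong₂ app (⟪⟫-identity t ht) (⟪⟫-identity u hu)
⟪⟫-identity (lam a A t) h = cong (lam a A) (⟪⟫-identity t h)
⟪⟫-identity (case A t u r q) h =
  let ht , h′ = All.++⁻ (fv t) h; hu , h″ = All.++⁻ (fv u) h′; hr , hq = All.++⁻ (fv r) h″ in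
  cong₄ (case A) (⟪⟫-identity t ht) (⟪⟫-identity u hu) (⟪⟫-identity r hr) (⟪⟫-identity q hq)
⟪⟫-identity (recursion A t u r) h =
  let ht , h′ = All.++⁻ (fv t) h; hu , hr = All.++⁻ (fv u) h′ in
  cong₃ (recursion A) (⟪⟫-identity t ht) (⟪⟫-identity u hu) (⟪⟫-identity r hr)

∉-++⁺ : ∀ {z : Name} xs {ys} → z ∉ xs → z ∉ ys → z ∉ xs ++ ys
∉-++⁺ xs z∉xs z∉ys = [ z∉xs , z∉ys ]′ ∘ ∈-++⁻ xs

∉-fv-⟪⟫ : ∀ {σ z} t → All (λ y → z ∉ fv (σ y)) (fv t) → z ∉ fv (t ⟪ σ ⟫)
∉-fv-⟪⟫ (bvar i) _ ()
∉-fv-⟪⟫ (fvar y) (h ∷ []) = h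
∉-fv-⟪⟫ (const c) _ ()
∉-fv-⟪⟫ (app t u) h =
  let ht , hu = All.++⁻ (fv t) h in
  ∉-++⁺ _ (∉-fv-⟪⟫ t ht) (∉-fv-⟪⟫ u hu)
∉-fv-⟪⟫ (lam a A t) h = ∉-fv-⟪⟫ t h
∉-fv-⟪⟫ (case A t u r q) h =
  let ht , h′ = All.++⁻ (fv t) h; hu , h″ = All.++⁻ (fv u) h′; hr , hq = All.++⁻ (fv r) h″ in
  ∉-++⁺ _ (∉-fv-⟪⟫ t ht) (∉-++⁺ _ (∉-fv-⟪⟫ u hu) (∉-++⁺ _ (∉-fv-⟪⟫ r hr) (∉-fv-⟪⟫ q hq)))
∉-fv-⟪⟫ (recursion A t u r) h =
  let ht , h′ = All.++⁻ (fv t) h; hu , hr = All.++⁻ (fv u) h′ in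
  ∉-++⁺ _ (∉-fv-⟪⟫ t ht) (∉-++⁺ _ (∉-fv-⟪⟫ u hu) (∉-fv-⟪⟫ r hr))

fv⊆fv-openAt : ∀ k u t → fv t ⊆ fv (openAt k u t)
fv⊆fv-openAt k u (bvar i) ()
fv⊆fv-openAt k u (fvar y) p = p
fv⊆fv-openAt k u (const c) ()
fv⊆fv-openAt k u (app t v) = ⊆.++⁺ (fv⊆fv-openAt k u t) (fv⊆fv-openAt k u v)
fv⊆fv-openAt k u (lam a A t) = fv⊆fv-openAt (suc k) u t
fv⊆fv-openAt k u (case A t v r q) =
  ⊆.++⁺ (fv⊆fv-openAt k u t) (⊆.++⁺ (fv⊆fv-openAt k u v) (⊆.++⁺ (fv⊆fv-openAt k u r) (fv⊆fv-openAt k u q)))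
fv⊆fv-openAt k u (recursion A t v r) =
  ⊆.++⁺ (fv⊆fv-openAt k u t) (⊆.++⁺ (fv⊆fv-openAt k u v) (fv⊆fv-openAt k u r))

↦-≢ : ∀ {x y} s → x ≢ y → (x ↦ s) y ≡ fvar y
↦-≢ {x} {y} s x≢y with x ≟ y
... | yes x≡y = ⊥-elim (x≢y x≡y)
... | no  _   = refl

↦-LC : ∀ {x s} → LC 0 s → ∀ y → LC 0 ((x ↦ s) y)
↦-LC {x} lc y with x ≟ y
... | yes _ = lc
... | no  _ = lc-fvar

subst-fresh : ∀ {x} s t → x ∉ fv t → t [ x ≔ s ] ≡ t
subst-fresh {x} s t x∉t = trans ([≔]-≡-⟪↦⟫ t x s)
  (⟪⟫-identity t (All.tabulate λ y∈t → ↦-≢ s λ { refl → x∉t y∈t }))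

subst-open-var : ∀ {x y s} t → x ≢ y → LC 0 s → open-var t y [ x ≔ s ] ≡ open-var (t [ x ≔ s ]) y
subst-open-var {x} {y} {s} t x≢y lc = begin
  open-var t y [ x ≔ s ]                        ≡⟨ [≔]-≡-⟪↦⟫ (open-var t y) x s ⟩
  open-var t y ⟪ x ↦ s ⟫                        ≡⟨ ⟪⟫-openAt (↦-LC lc) 0 (fvar y) t ⟩
  openAt 0 ((x ↦ s) y) (t ⟪ x ↦ s ⟫)            ≡⟨ cong₂ (openAt 0) (↦-≢ s x≢y) (sym ([≔]-≡-⟪↦⟫ t x s)) ⟩
  open-var (t [ x ≔ s ]) y                      ∎
  where open ≡-Reasoning

∉-fv-subst : ∀ {x z} s t → z ∉ fv t → z ∉ fv s → z ∉ fv (t [ x ≔ s ])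
∉-fv-subst {x} {z} s t z∉t z∉s rewrite [≔]-≡-⟪↦⟫ t x s = ∉-fv-⟪⟫ t (All.tabulate z∉x↦s)
  where
  z∉x↦s : ∀ {y} → y ∈ fv t → z ∉ fv ((x ↦ s) y)
  z∉x↦s {y} y∈t with x ≟ y
  ... | yes _ = z∉s
  ... | no  _ = λ { (here refl) → z∉t y∈t }

rename-open-var : ∀ f t y → rename f (open-var t y) ≡ open-var (rename f t) (f y)
rename-open-var f t y = ⟪⟫-openAt (λ _ → lc-fvar) 0 (fvar y) t

∉-fv-rename : ∀ {f} → Injective _≡_ _≡_ f → ∀ {w} t → w ∉ fv t → f w ∉ fv (rename f t)
∉-fv-rename inj t w∉t = ∉-fv-⟪⟫ t (All.tabulate λ { y∈t (here fw≡fy) → w∉t (subst (_∈ fv t) (sym (inj fw≡fy)) y∈t) })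

rename-identity : ∀ {f} t → All (λ y → f y ≡ y) (fv t) → rename f t ≡ t
rename-identity t fixed = ⟪⟫-identity t (All.map (cong fvar) fixed)

depth : Term → ℕ
depth (bvar _)            = 0
depth (fvar _)            = 0
depth (const _)           = 0
depth (app t u)           = suc (depth t ⊔ depth u)
depth (lam _ _ t)         = suc (depth t)
depth (case _ t u r q)    = suc (depth t ⊔ (depth u ⊔ (depth r ⊔ depth q)))
depth (recursion _ t u r) = suc (depth t ⊔ (depth u ⊔ depth r))

depth-openAt : ∀ k y t → depth (openAt k (fvar y) t) ≡ depth t
depth-openAt k y (bvar i) with k ≟ i
... | yes _ = refl
... | no  _ = refl
depth-openAt k y (fvar z) = refl
depth-openAt k y (const c) = refl
depth-openAt k y (app t u) = cong suc (cong₂ _⊔_ (depth-openAt k y t) (depth-openAt k y u))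
depth-openAt k y (lam a A t) = cong suc (depth-openAt (suc k) y t)
depth-openAt k y (case A t u r q) =
  cong suc (cong₄ (λ a b c d → a ⊔ (b ⊔ (c ⊔ d)))
                  (depth-openAt k y t) (depth-openAt k y u) (depth-openAt k y r) (depth-openAt k y q))
depth-openAt k y (recursion A t u r) =
  cong suc (cong₃ (λ a b c → a ⊔ (b ⊔ c)) (depth-openAt k y t) (depth-openAt k y u) (depth-openAt k y r))

depth-app⁻ : ∀ t u {n} → depth (app t u) ≤ suc n → depth t ≤ n × depth u ≤ n
depth-app⁻ t u (s≤s h) = m⊔n≤o⇒m≤o (depth t) (depth u) h , m⊔n≤o⇒n≤o (depth t) (depth u) h

depth-recursion⁻ : ∀ {A} t u r {n} → depth (recursion A t u r) ≤ suc n →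
                   depth t ≤ n × depth u ≤ n × depth r ≤ n
depth-recursion⁻ t u r (s≤s h) =
  m⊔n≤o⇒m≤o (depth t) _ h , m⊔n≤o⇒m≤o (depth u) (depth r) hᵘʳ , m⊔n≤o⇒n≤o (depth u) (depth r) hᵘʳ
  where hᵘʳ = m⊔n≤o⇒n≤o (depth t) _ h

depth-case⁻ : ∀ {A} t u r q {n} → depth (case A t u r q) ≤ suc n →
              depth t ≤ n × depth u ≤ n × depth r ≤ n × depth q ≤ n
depth-case⁻ t u r q (s≤s h) =
  m⊔n≤o⇒m≤o (depth t) _ h , m⊔n≤o⇒m≤o (depth u) _ hᵘʳq ,
  m⊔n≤o⇒m≤o (depth r) (depth q) hʳq , m⊔n≤o⇒n≤o (depth r) (depth q) hʳq
  where
  hᵘʳq = m⊔n≤o⇒n≤o (depth t) _ h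
  hʳq  = m⊔n≤o⇒n≤o (depth u) _ hᵘʳq

-- Contexts with distinct names

dom : Ctx → List Name
dom = map nm

∈-dom⁺ : ∀ {d Γ} → d ∈ Γ → nm d ∈ dom Γ
∈-dom⁺ = ∈-map⁺ nm

∈-dom⁻ : ∀ {y Γ} → y ∈ dom Γ → ∃ λ d → d ∈ Γ × y ≡ nm d
∈-dom⁻ = ∈-map⁻ nm

dom-⊆ : ∀ {Γ Δ} → Γ ⊆ Δ → dom Γ ⊆ dom Δ
dom-⊆ = ⊆.map⁺ nm

∈-dom-++⁻ : ∀ {y} Γ {Δ} → y ∈ dom (Γ ++ Δ) → y ∈ dom Γ ⊎ y ∈ dom Δ
∈-dom-++⁻ Γ {Δ} p = ∈-++⁻ (dom Γ) (subst (_ ∈_) (map-++ nm Γ Δ) p)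

∈-dom-++⁺ˡ : ∀ {y Γ Δ} → y ∈ dom Γ → y ∈ dom (Γ ++ Δ)
∈-dom-++⁺ˡ {Γ = Γ} {Δ} = dom-⊆ (⊆.xs⊆xs++ys Γ Δ)

∈-dom-++⁺ʳ : ∀ {y} Γ {Δ} → y ∈ dom Δ → y ∈ dom (Γ ++ Δ)
∈-dom-++⁺ʳ Γ {Δ} = dom-⊆ (⊆.xs⊆ys++xs Δ Γ)

Valid-↭ : ∀ {Γ Δ} → Γ ↭ Δ → Valid Γ → Valid Δ
Valid-↭ p = Unique-resp-↭ (setoid Name) (↭⇒↭ₛ (↭.map⁺ nm p))

Valid-∷⁺ : ∀ d {Γ} → nm d ∉ dom Γ → Valid Γ → Valid (d ∷ Γ)
Valid-∷⁺ _ d∉Γ v = All.¬Any⇒All¬ _ d∉Γ ∷ v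

Valid-∷⁻ : ∀ d {Γ} → Valid (d ∷ Γ) → nm d ∉ dom Γ
Valid-∷⁻ _ = Unique.Unique[x∷xs]⇒x∉xs

Valid-++⁻ʳ : ∀ Γ {Δ} → Valid (Γ ++ Δ) → Valid Δ
Valid-++⁻ʳ []      v       = v
Valid-++⁻ʳ (_ ∷ Γ) (_ ∷ v) = Valid-++⁻ʳ Γ v

Valid-++⁻ˡ : ∀ Γ {Δ} → Valid (Γ ++ Δ) → Valid Γ
Valid-++⁻ˡ Γ {Δ} v = Valid-++⁻ʳ Δ (Valid-↭ (↭.++-comm Γ Δ) v)

Valid-++-disjoint : ∀ Γ {Δ y} → Valid (Γ ++ Δ) → y ∈ dom Γ → y ∉ dom Δ
Valid-++-disjoint (_ ∷ Γ) (d∉ ∷ _) (here refl) q = All.lookup d∉ (∈-dom-++⁺ʳ Γ q) refl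
Valid-++-disjoint (_ ∷ Γ) (_ ∷ v)  (there p)   q = Valid-++-disjoint Γ v p q

Valid-filter : ∀ {P : Decl → Set} (P? : Decidable P) {Γ} → Valid Γ → Valid (filter P? Γ)
Valid-filter P? = AllPairs.map⁺ ∘ AllPairs.filter⁺ P? ∘ AllPairs.map⁻

Valid-nm-injective : ∀ {Γ d e} → Valid Γ → d ∈ Γ → e ∈ Γ → nm d ≡ nm e → d ≡ e
Valid-nm-injective _          (here refl) (here refl) _  = refl
Valid-nm-injective (d∉ ∷ _) (here refl) (there q)   eq = ⊥-elim (All.lookup d∉ (∈-dom⁺ q) eq)
Valid-nm-injective (e∉ ∷ _) (there p)   (here refl) eq = ⊥-elim (All.lookup e∉ (∈-dom⁺ p) (sym eq))
Valid-nm-injective (_ ∷ v)  (there p)   (there q)   eq = Valid-nm-injective v p q eq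

↭-from-⊆-⊇ : ∀ {Γ Δ} → Valid Γ → Valid Δ → Γ ⊆ Δ → Δ ⊆ Γ → Γ ↭ Δ
↭-from-⊆-⊇ vΓ vΔ Γ⊆Δ Δ⊆Γ = ∼bag⇒↭ (unique∧set⇒bag (Unique.map⁻ vΓ) (Unique.map⁻ vΔ) (mk⇔ Γ⊆Δ Δ⊆Γ))

nm∈? : (ns : List Name) → Decidable (λ d → nm d ∈ ns)
nm∈? ns d = nm d ∈? ns

nm∉? : (ns : List Name) → Decidable (λ d → nm d ∉ ns)
nm∉? ns d = nm d ∉? ns

restrict exclude : List Name → Ctx → Ctx
restrict ns = filter (nm∈? ns)
exclude  ns = filter (nm∉? ns)

↭-restrict-exclude : ∀ ns Γ → Γ ↭ restrict ns Γ ++ exclude ns Γ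
↭-restrict-exclude ns []      = ↭-refl
↭-restrict-exclude ns (d ∷ Γ) with nm d ∈? ns
... | yes _ = ↭-prep d (↭-restrict-exclude ns Γ)
... | no  _ = ↭-trans (↭-prep d (↭-restrict-exclude ns Γ)) (↭-sym (↭.shift d (restrict ns Γ) _))

Compatible : Ctx → Ctx → Set
Compatible C Γ = ∀ {d} → d ∈ C → nm d ∈ dom Γ → d ∈ Γ

Compatible-⊆ : ∀ {C Γ Δ} → Valid Γ → Compatible C Γ → Δ ⊆ Γ → Compatible C Δ
Compatible-⊆ vΓ comp Δ⊆Γ d∈C y∈Δ with e , e∈Δ , refl ← ∈-dom⁻ y∈Δ
  with refl ← Valid-nm-injective vΓ (comp d∈C (dom-⊆ Δ⊆Γ y∈Δ)) (Δ⊆Γ e∈Δ) refl = e∈Δ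

Compatible-∈ : ∀ {C Γ d} → Valid Γ → Compatible C Γ → d ∈ Γ → nm d ∈ dom C → d ∈ C
Compatible-∈ vΓ comp d∈Γ y∈C with c , c∈C , eq ← ∈-dom⁻ y∈C
  with refl ← Valid-nm-injective vΓ d∈Γ (comp c∈C (subst (_∈ dom _) eq (∈-dom⁺ d∈Γ))) eq = c∈C

restrict-↭-restrict : ∀ {ns L C} → Valid L → Valid C → Compatible C L → dom C ⊆ ns →
                      (∀ {d} → d ∈ L → nm d ∈ ns → nm d ∈ dom C) →
                      restrict ns L ↭ restrict (dom L) C
restrict-↭-restrict {ns} {L} {C} vL vC comp C⊆ns L∩ns⊆C =
  ↭-from-⊆-⊇ (Valid-filter _ vL) (Valid-filter _ vC) forth back
  where
  forth : restrict ns L ⊆ restrict (dom L) C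
  forth p with d∈L , d∈ns ← ∈-filter⁻ _ p =
    ∈-filter⁺ _ (Compatible-∈ vL comp d∈L (L∩ns⊆C d∈L d∈ns)) (∈-dom⁺ d∈L)
  back : restrict (dom L) C ⊆ restrict ns L
  back p with d∈C , d∈L ← ∈-filter⁻ _ p = ∈-filter⁺ _ (comp d∈C d∈L) (C⊆ns (∈-dom⁺ d∈C))

Valid-∷-⊆ : ∀ d {Γ Δ} → Valid (d ∷ Γ) → Δ ⊆ Γ → Valid Δ → Valid (d ∷ Δ)
Valid-∷-⊆ d v Δ⊆Γ vΔ = Valid-∷⁺ d (λ p → Valid-∷⁻ d v (dom-⊆ Δ⊆Γ p)) vΔ

Valid-++-take : ∀ A B {C} → Valid (A ++ B ++ C) → Valid (A ++ B)
Valid-++-take A B {C} v = Valid-++⁻ˡ (A ++ B) (subst Valid (sym (++-assoc A B C)) v)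

Valid-++-drop : ∀ A B {C} → Valid (A ++ B ++ C) → Valid (A ++ C)
Valid-++-drop A B {C} v = Valid-++⁻ʳ B (Valid-↭ (↭.shifts A B) v)

-- Structural properties of typing: permutation, renaming and weakening

⊢-valid : ∀ {Γ t A} → Γ ⊢ t ∶ A → Valid Γ
⊢-valid (ty-var v _)                = v
⊢-valid (ty-sub D _)                = ⊢-valid D
⊢-valid (ty-lam _ _ D) with _ ∷ v ← ⊢-valid D = v
⊢-valid (ty-const v)                = v
⊢-valid (ty-case _ _ _ v _ _ _ _)   = v
⊢-valid (ty-rec _ _ _ _ v _ _ _)    = v
⊢-valid (ty-app _ _ _ v _ _)        = v

⊢-↭ : ∀ {Γ Δ t A} → Γ ↭ Δ → Γ ⊢ t ∶ A → Δ ⊢ t ∶ A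
⊢-↭ p (ty-var v m)              = ty-var (Valid-↭ p v) (↭.∈-resp-↭ p m)
⊢-↭ p (ty-sub D s)              = ty-sub (⊢-↭ p D) s
⊢-↭ p (ty-lam x x∉t D)          = ty-lam x x∉t (⊢-↭ (↭-prep _ p) D)
⊢-↭ p (ty-const v)              = ty-const (Valid-↭ p v)
⊢-↭ p (ty-case nA bf q v D₁ D₂ D₃ D₄) = ty-case nA bf (↭-trans (↭-sym p) q) (Valid-↭ p v) D₁ D₂ D₃ D₄
⊢-↭ p (ty-rec {Γ₁ = G₁} {Γ₂ = G₂} {Δ₁ = E₁} {Δ₂ = E₂} nA bf lt q v D₁ D₂ D₃) =
  ty-rec {Γ₁ = G₁} {Γ₂ = G₂} {Δ₁ = E₁} {Δ₂ = E₂} nA bf lt (↭-trans (↭-sym p) q) (Valid-↭ p v) D₁ D₂ D₃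
⊢-↭ p (ty-app nA lt q v D₁ D₂)  = ty-app nA lt (↭-trans (↭-sym p) q) (Valid-↭ p v) D₁ D₂

module _ {Ξ : Ctx} where
  private
    from : ∀ {Ψ} → Ξ ↭ Ψ → Ψ ⊆ Ξ
    from p = ⊆.⊆-reflexive-↭ (↭-sym p)

  case-⊆₁ : ∀ G E₁ E₂ E₃ E₄ → Ξ ↭ G ++ E₁ ++ E₂ ++ E₃ ++ E₄ → G ++ E₁ ⊆ Ξ
  case-⊆₁ G E₁ E₂ E₃ E₄ p = ⊆.⊆-trans (⊆.++⁺ʳ G (⊆.xs⊆xs++ys E₁ _)) (from p)

  case-⊆₂ : ∀ G E₁ E₂ E₃ E₄ → Ξ ↭ G ++ E₁ ++ E₂ ++ E₃ ++ E₄ → G ++ E₂ ⊆ Ξ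
  case-⊆₂ G E₁ E₂ E₃ E₄ p =
    ⊆.⊆-trans (⊆.++⁺ʳ G (⊆.⊆-trans (⊆.xs⊆xs++ys E₂ _) (⊆.xs⊆ys++xs _ E₁))) (from p)

  case-⊆₃ : ∀ G E₁ E₂ E₃ E₄ → Ξ ↭ G ++ E₁ ++ E₂ ++ E₃ ++ E₄ → G ++ E₃ ⊆ Ξ
  case-⊆₃ G E₁ E₂ E₃ E₄ p =
    ⊆.⊆-trans (⊆.++⁺ʳ G (⊆.⊆-trans (⊆.xs⊆xs++ys E₃ _) (⊆.⊆-trans (⊆.xs⊆ys++xs _ E₂) (⊆.xs⊆ys++xs _ E₁)))) (from p)

  case-⊆₄ : ∀ G E₁ E₂ E₃ E₄ → Ξ ↭ G ++ E₁ ++ E₂ ++ E₃ ++ E₄ → G ++ E₄ ⊆ Ξ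
  case-⊆₄ G E₁ E₂ E₃ E₄ p =
    ⊆.⊆-trans (⊆.++⁺ʳ G (⊆.⊆-trans (⊆.xs⊆ys++xs E₄ E₃) (⊆.⊆-trans (⊆.xs⊆ys++xs _ E₂) (⊆.xs⊆ys++xs _ E₁)))) (from p)

  rec-⊆₁ : ∀ G₁ G₂ E₁ E₂ → Ξ ↭ (G₁ ++ G₂) ++ (E₁ ++ E₂) → G₁ ++ E₁ ⊆ Ξ
  rec-⊆₁ G₁ G₂ E₁ E₂ p = ⊆.⊆-trans (⊆.++⁺ (⊆.xs⊆xs++ys G₁ G₂) (⊆.xs⊆xs++ys E₁ E₂)) (from p)

  rec-⊆₂ : ∀ G₁ G₂ E₁ E₂ → Ξ ↭ (G₁ ++ G₂) ++ (E₁ ++ E₂) → (G₁ ++ G₂) ++ E₂ ⊆ Ξ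
  rec-⊆₂ G₁ G₂ E₁ E₂ p = ⊆.⊆-trans (⊆.++⁺ʳ (G₁ ++ G₂) (⊆.xs⊆ys++xs E₂ E₁)) (from p)

  rec-⊆₃ : ∀ G₁ G₂ E₁ E₂ → Ξ ↭ (G₁ ++ G₂) ++ (E₁ ++ E₂) → (G₁ ++ G₂) ++ [] ⊆ Ξ
  rec-⊆₃ G₁ G₂ E₁ E₂ p = ⊆.⊆-trans (⊆.++⁺ʳ (G₁ ++ G₂) (λ ())) (from p)

  app-⊆₁ : ∀ G E₁ E₂ → Ξ ↭ G ++ E₁ ++ E₂ → G ++ E₁ ⊆ Ξ
  app-⊆₁ G E₁ E₂ p = ⊆.⊆-trans (⊆.++⁺ʳ G (⊆.xs⊆xs++ys E₁ E₂)) (from p)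

  app-⊆₂ : ∀ G E₁ E₂ → Ξ ↭ G ++ E₁ ++ E₂ → G ++ E₂ ⊆ Ξ
  app-⊆₂ G E₁ E₂ p = ⊆.⊆-trans (⊆.++⁺ʳ G (⊆.xs⊆ys++xs E₂ E₁)) (from p)

fv⊆dom : ∀ {Γ t A} → Γ ⊢ t ∶ A → fv t ⊆ dom Γ
fv⊆dom (ty-var _ m) (here refl) = ∈-dom⁺ m
fv⊆dom (ty-sub D _) = fv⊆dom D
fv⊆dom {t = lam _ _ t} (ty-lam x x∉t D) y∈t with fv⊆dom D (fv⊆fv-openAt 0 (fvar x) t y∈t)
... | here refl = ⊥-elim (x∉t y∈t)
... | there y∈Γ = y∈Γ
fv⊆dom (ty-const _) ()
fv⊆dom {t = case _ t u r q} (ty-case {Γ = G} {E₁} {E₂} {E₃} {E₄} _ _ p _ D₁ D₂ D₃ D₄) =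
  [ in₁ , [ in₂ , [ in₃ , in₄ ]′ ∘ ∈-++⁻ (fv r) ]′ ∘ ∈-++⁻ (fv u) ]′ ∘ ∈-++⁻ (fv t)
  where
  in₁ = dom-⊆ (case-⊆₁ G E₁ E₂ E₃ E₄ p) ∘ fv⊆dom D₁
  in₂ = dom-⊆ (case-⊆₂ G E₁ E₂ E₃ E₄ p) ∘ fv⊆dom D₂
  in₃ = dom-⊆ (case-⊆₃ G E₁ E₂ E₃ E₄ p) ∘ fv⊆dom D₃
  in₄ = dom-⊆ (case-⊆₄ G E₁ E₂ E₃ E₄ p) ∘ fv⊆dom D₄
fv⊆dom {t = recursion _ t u r} (ty-rec {Γ₁ = G₁} {G₂} {E₁} {E₂} _ _ _ p _ D₁ D₂ D₃) =
  [ dom-⊆ (rec-⊆₁ G₁ G₂ E₁ E₂ p) ∘ fv⊆dom D₁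
  , [ dom-⊆ (rec-⊆₂ G₁ G₂ E₁ E₂ p) ∘ fv⊆dom D₂ , dom-⊆ (rec-⊆₃ G₁ G₂ E₁ E₂ p) ∘ fv⊆dom D₃ ]′ ∘ ∈-++⁻ (fv u)
  ]′ ∘ ∈-++⁻ (fv t)
fv⊆dom {t = app t u} (ty-app {Γ = G} {E₁} {E₂} _ _ p _ D₁ D₂) =
  [ dom-⊆ (app-⊆₁ G E₁ E₂ p) ∘ fv⊆dom D₁ , dom-⊆ (app-⊆₂ G E₁ E₂ p) ∘ fv⊆dom D₂ ]′ ∘ ∈-++⁻ (fv t)

⊢-LC : ∀ {Γ t A} → Γ ⊢ t ∶ A → LC 0 t
⊢-LC (ty-var _ _)                  = lc-fvar
⊢-LC (ty-sub D _)                  = ⊢-LC D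
⊢-LC {t = lam _ _ t} (ty-lam x _ D) = lc-lam (LC-openAt⁻ 0 x t (⊢-LC D))
⊢-LC (ty-const _)                  = lc-const
⊢-LC (ty-case _ _ _ _ D₁ D₂ D₃ D₄) = lc-case (⊢-LC D₁) (⊢-LC D₂) (⊢-LC D₃) (⊢-LC D₄)
⊢-LC (ty-rec _ _ _ _ _ D₁ D₂ D₃)   = lc-recursion (⊢-LC D₁) (⊢-LC D₂) (⊢-LC D₃)
⊢-LC (ty-app _ _ _ _ D₁ D₂)        = lc-app (⊢-LC D₁) (⊢-LC D₂)

-- The side conditions of the rules (AllN, <:ₐ) only constrain aspects and types, hence All-mono.
record CtxMap : Set₁ where
  field
    apply  : Ctx → Ctx
    []-hom : apply [] ≡ []
    ++-hom : ∀ Γ Δ → apply (Γ ++ Δ) ≡ apply Γ ++ apply Δ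
    ↭-mono : ∀ {Γ Δ} → Γ ↭ Δ → apply Γ ↭ apply Δ
    All-mono : ∀ {Q : Aspect → Type → Set} {Γ} →
               All (λ d → Q (asp d) (ty d)) Γ → All (λ d → Q (asp d) (ty d)) (apply Γ)

module _ (Φ : CtxMap) where
  open CtxMap Φ

  ty-case-map : ∀ {Ξ G E₁ E₂ E₃ E₄ t₁ t₂ t₃ t₄ A} → AllN G → BoxFree A →
    Ξ ↭ G ++ E₁ ++ E₂ ++ E₃ ++ E₄ → Valid (apply Ξ) →
    apply (G ++ E₁) ⊢ t₁ ∶ N → apply (G ++ E₂) ⊢ t₂ ∶ A → apply (G ++ E₃) ⊢ t₃ ∶ A → apply (G ++ E₄) ⊢ t₄ ∶ A →
    apply Ξ ⊢ case A t₁ t₂ t₃ t₄ ∶ A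
  ty-case-map {G = G} {E₁} {E₂} {E₃} {E₄} nA bf p v D₁ D₂ D₃ D₄
    with ↭-mono p
  ... | p′ rewrite ++-hom G E₁ | ++-hom G E₂ | ++-hom G E₃ | ++-hom G E₄
                 | ++-hom G (E₁ ++ E₂ ++ E₃ ++ E₄) | ++-hom E₁ (E₂ ++ E₃ ++ E₄)
                 | ++-hom E₂ (E₃ ++ E₄) | ++-hom E₃ E₄ =
    ty-case (All-mono nA) bf p′ v D₁ D₂ D₃ D₄

  ty-rec-map : ∀ {Ξ G₁ G₂ E₁ E₂ t s r A} → AllN (G₁ ++ G₂) → BoxFree A → (G₁ ++ E₁) <:ₐ □ →
    Ξ ↭ (G₁ ++ G₂) ++ (E₁ ++ E₂) → Valid (apply Ξ) →
    apply (G₁ ++ E₁) ⊢ t ∶ N → apply ((G₁ ++ G₂) ++ E₂) ⊢ s ∶ A →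
    apply ((G₁ ++ G₂) ++ []) ⊢ r ∶ (□ ▹ N ⇒ ■ ▹ A ⇒ A) →
    apply Ξ ⊢ recursion A t s r ∶ A
  ty-rec-map {G₁ = G₁} {G₂} {E₁} {E₂} nA bf lt p v D₁ D₂ D₃
    with All-mono nA | All-mono lt | ↭-mono p
  ... | nA′ | lt′ | p′
    rewrite ++-hom (G₁ ++ G₂) E₂ | ++-hom (G₁ ++ G₂) [] | ++-hom (G₁ ++ G₂) (E₁ ++ E₂)
          | ++-hom E₁ E₂ | ++-hom G₁ G₂ | ++-hom G₁ E₁ | []-hom =
    ty-rec {Γ₁ = apply G₁} {apply G₂} {apply E₁} {apply E₂} nA′ bf lt′ p′ v D₁ D₂ D₃

  ty-app-map : ∀ {Ξ G E₁ E₂ t s a A B} → AllN G → (G ++ E₂) <:ₐ a →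
    Ξ ↭ G ++ E₁ ++ E₂ → Valid (apply Ξ) →
    apply (G ++ E₁) ⊢ t ∶ (a ▹ A ⇒ B) → apply (G ++ E₂) ⊢ s ∶ A →
    apply Ξ ⊢ app t s ∶ B
  ty-app-map {G = G} {E₁} {E₂} nA lt p v D₁ D₂
    with All-mono lt | ↭-mono p
  ... | lt′ | p′ rewrite ++-hom G E₁ | ++-hom G E₂ | ++-hom G (E₁ ++ E₂) | ++-hom E₁ E₂ =
    ty-app (All-mono nA) lt′ p′ v D₁ D₂

renameDecl : (Name → Name) → Decl → Decl
renameDecl f d = f (nm d) ∶[ asp d ] ty d

renameCtx : (Name → Name) → Ctx → Ctx
renameCtx f = map (renameDecl f)

renameMap : (Name → Name) → CtxMap
renameMap f = record
  { apply    = renameCtx f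
  ; []-hom   = refl
  ; ++-hom   = map-++ (renameDecl f)
  ; ↭-mono   = ↭.map⁺ (renameDecl f)
  ; All-mono = All.map⁺
  }

Valid-renameCtx : ∀ {f} → Injective _≡_ _≡_ f → ∀ {Γ} → Valid Γ → Valid (renameCtx f Γ)
Valid-renameCtx {f} inj {Γ} v =
  subst Unique (trans (sym (map-∘ {g = f} {f = nm} Γ)) (map-∘ {g = nm} {f = renameDecl f} Γ)) (Unique.map⁺ inj v)

⊢-rename : ∀ {f} → Injective _≡_ _≡_ f → ∀ {Γ t A} → Γ ⊢ t ∶ A → renameCtx f Γ ⊢ rename f t ∶ A
⊢-rename inj (ty-var v m) = ty-var (Valid-renameCtx inj v) (∈-map⁺ _ m)
⊢-rename inj (ty-sub D s) = ty-sub (⊢-rename inj D) s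
⊢-rename {f} inj (ty-lam {t = t} x x∉t D) =
  ty-lam (f x) (∉-fv-rename inj t x∉t) (subst (_ ⊢_∶ _) (rename-open-var f t x) (⊢-rename inj D))
⊢-rename inj (ty-const v) = ty-const (Valid-renameCtx inj v)
⊢-rename {f} inj (ty-case nA bf p v D₁ D₂ D₃ D₄) =
  ty-case-map (renameMap f) nA bf p (Valid-renameCtx inj v)
    (⊢-rename inj D₁) (⊢-rename inj D₂) (⊢-rename inj D₃) (⊢-rename inj D₄)
⊢-rename {f} inj (ty-rec {Γ₁ = G₁} {G₂} {E₁} {E₂} nA bf lt p v D₁ D₂ D₃) =
  ty-rec-map (renameMap f) {G₁ = G₁} {G₂} {E₁} {E₂} nA bf lt p (Valid-renameCtx inj v)
    (⊢-rename inj D₁) (⊢-rename inj D₂) (⊢-rename inj D₃)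
⊢-rename {f} inj (ty-app nA lt p v D₁ D₂) =
  ty-app-map (renameMap f) nA lt p (Valid-renameCtx inj v) (⊢-rename inj D₁) (⊢-rename inj D₂)

⊢-rename-body : ∀ {Γ t a A B y w} → y ∉ fv t → w ∉ fv t → w ∉ dom Γ →
                (y ∶[ a ] A) ∷ Γ ⊢ open-var t y ∶ B → (w ∶[ a ] A) ∷ Γ ⊢ open-var t w ∶ B
⊢-rename-body {Γ} {t} {a} {A} {B} {y} {w} y∉t w∉t w∉Γ D =
  subst₂ (_⊢_∶ B) context≡ term≡ (⊢-rename (swap-injective y w) D)
  where
  y∉Γ : y ∉ dom Γ
  y∉Γ = Valid-∷⁻ (y ∶[ a ] A) (⊢-valid D)

  fixes : ∀ {z} → z ∈ dom Γ ⊎ z ∈ fv t → swap y w z ≡ z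
  fixes (inj₁ z∈Γ) = swap-other (λ { refl → y∉Γ z∈Γ }) (λ { refl → w∉Γ z∈Γ })
  fixes (inj₂ z∈t) = swap-other (λ { refl → y∉t z∈t }) (λ { refl → w∉t z∈t })

  context≡ : renameCtx (swap y w) ((y ∶[ a ] A) ∷ Γ) ≡ (w ∶[ a ] A) ∷ Γ
  context≡ = cong₂ _∷_ (cong (_∶[ a ] A) (swap-left y w))
    (map-id-local (All.tabulate λ {d} d∈Γ → cong (_∶[ asp d ] ty d) (fixes (inj₁ (∈-dom⁺ d∈Γ)))))

  term≡ : rename (swap y w) (open-var t y) ≡ open-var t w
  term≡ = trans (rename-open-var (swap y w) t y)
    (cong₂ open-var (rename-identity t (All.tabulate (fixes ∘ inj₂))) (swap-left y w))

⊢-weaken : ∀ n {Γ t A} e → depth t ≤ n → Γ ⊢ t ∶ A → Valid (e ∷ Γ) → e ∷ Γ ⊢ t ∶ A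
⊢-weaken n e _ (ty-var _ m) v = ty-var v (there m)
⊢-weaken n e h (ty-sub D s) v = ty-sub (⊢-weaken n e h D v) s
⊢-weaken (suc n) e (s≤s h) (ty-lam {Γ = Γ} {t} {a} {A} y y∉t D) v =
  ty-lam w w∉t (⊢-↭ (↭-swap e _ ↭-refl) (⊢-weaken n e h′ (⊢-rename-body {t = t} y∉t w∉t w∉Γ D) v′))
  where
  w : Name
  w = fresh (nm e ∷ dom Γ ++ fv t)
  w∉ : w ∉ nm e ∷ dom Γ ++ fv t
  w∉ = fresh-∉ _
  w∉t : w ∉ fv t
  w∉t = w∉ ∘ there ∘ ∈-++⁺ʳ (dom Γ)
  w∉Γ : w ∉ dom Γ
  w∉Γ = w∉ ∘ there ∘ ∈-++⁺ˡ
  h′ : depth (open-var t w) ≤ n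
  h′ = subst (_≤ n) (sym (depth-openAt 0 w t)) h
  v′ : Valid (e ∷ (w ∶[ a ] A) ∷ Γ)
  v′ = Valid-∷⁺ e {(w ∶[ a ] A) ∷ Γ} (λ { (here e≡w) → w∉ (here (sym e≡w)) ; (there p) → Valid-∷⁻ e v p })
         (Valid-∷⁺ (w ∶[ a ] A) {Γ} w∉Γ (Valid-++⁻ʳ (e ∷ []) {Γ} v))
⊢-weaken n e _ (ty-const _) v = ty-const v
⊢-weaken (suc n) {t = case B t u r q} e h (ty-case {Γ = G} {E₁} {E₂} {E₃} {E₄} nA bf p _ D₁ D₂ D₃ D₄) v =
  ty-case nA bf (↭-trans (↭-prep e p) (↭-sym (↭.shift e G _))) v
    (⊢-↭ (↭-sym (↭.shift e G E₁))
      (⊢-weaken n e (proj₁ (depth-case⁻ {B} t u r q h)) D₁ (Valid-∷-⊆ e v (case-⊆₁ G E₁ E₂ E₃ E₄ p) (⊢-valid D₁))))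
    D₂ D₃ D₄
⊢-weaken (suc n) {t = recursion B t u r} e h (ty-rec {Γ₁ = G₁} {G₂} {E₁} {E₂} nA bf lt p _ D₁ D₂ D₃) v =
  ty-rec {Γ₁ = G₁} {G₂} {E₁} {e ∷ E₂} nA bf lt
    (↭-trans (↭-prep e p) (↭-trans (↭-sym (↭.shift e (G₁ ++ G₂) _)) (↭.++⁺ˡ (G₁ ++ G₂) (↭-sym (↭.shift e E₁ E₂)))))
    v D₁
    (⊢-↭ (↭-sym (↭.shift e (G₁ ++ G₂) E₂))
      (⊢-weaken n e (proj₁ (proj₂ (depth-recursion⁻ {B} t u r h))) D₂ (Valid-∷-⊆ e v (rec-⊆₂ G₁ G₂ E₁ E₂ p) (⊢-valid D₂))))
    D₃
⊢-weaken (suc n) {t = app t u} e h (ty-app {Γ = G} {E₁} {E₂} nA lt p _ D₁ D₂) v =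
  ty-app nA lt (↭-trans (↭-prep e p) (↭-sym (↭.shift e G _))) v
    (⊢-↭ (↭-sym (↭.shift e G E₁))
      (⊢-weaken n e (proj₁ (depth-app⁻ t u h)) D₁ (Valid-∷-⊆ e v (app-⊆₁ G E₁ E₂ p) (⊢-valid D₁))))
    D₂

⊢-weaken* : ∀ Δ {Γ t A} → Γ ⊢ t ∶ A → Valid (Δ ++ Γ) → Δ ++ Γ ⊢ t ∶ A
⊢-weaken* []      D _       = D
⊢-weaken* (e ∷ Δ) D v@(_ ∷ vΔΓ) = ⊢-weaken _ e ≤-refl (⊢-weaken* Δ D vΔΓ) v

-- Substituting a constant for a variable

without : Name → CtxMap
without x = record
  { apply    = exclude (x ∷ [])
  ; []-hom   = refl
  ; ++-hom   = filter-++ _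
  ; ↭-mono   = ↭.filter-↭ _
  ; All-mono = All.filter⁺ _
  }

exclude-∉ : ∀ {x Γ} → x ∉ dom Γ → exclude (x ∷ []) Γ ≡ Γ
exclude-∉ x∉Γ = filter-all (nm∉? _) (All.tabulate λ d∈Γ → λ { (here refl) → x∉Γ (∈-dom⁺ d∈Γ) })

⊢-subst-const : ∀ {M t A x c} → M ⊢ t ∶ A → (∀ {a B} → (x ∶[ a ] B) ∈ M → B ≡ typeOf c) →
                exclude (x ∷ []) M ⊢ t [ x ≔ const c ] ∶ A
⊢-subst-const {x = x} (ty-var {x = y} v m) x∶c with x ≟ y
... | yes refl = subst (_ ⊢ _ ∶_) (sym (x∶c m)) (ty-const (Valid-filter _ v))
... | no  x≢y  = ty-var (Valid-filter _ v) (∈-filter⁺ _ m λ { (here y≡x) → x≢y (sym y≡x) })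
⊢-subst-const (ty-sub D s) x∶c = ty-sub (⊢-subst-const D x∶c) s
⊢-subst-const {M} {x = x} {c} (ty-lam {t = t} {a} {A} {B} y y∉t D) x∶c with y ≟ x
... | yes refl =
  subst₂ (_⊢_∶ a ▹ A ⇒ B) (sym (exclude-∉ x∉M)) (sym (subst-fresh (const c) (lam a A t) x∉t)) (ty-lam y y∉t D)
  where
  x∉M : x ∉ dom M
  x∉M = Valid-∷⁻ (x ∶[ a ] A) (⊢-valid D)
  x∉t : x ∉ fv (lam a A t)
  x∉t = x∉M ∘ fv⊆dom (ty-lam {t = t} y y∉t D)
... | no  y≢x  =
  ty-lam y (∉-fv-subst (const c) t y∉t λ ())
    (subst₂ (_⊢_∶ B) (filter-accept (nm∉? (x ∷ [])) λ { (here y≡x) → y≢x y≡x })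
                     (subst-open-var t (y≢x ∘ sym) lc-const)
      (⊢-subst-const D λ { (here refl) → ⊥-elim (y≢x refl) ; (there m) → x∶c m }))
⊢-subst-const (ty-const v) x∶c = ty-const (Valid-filter _ v)
⊢-subst-const {x = x} (ty-case {Γ = G} {E₁} {E₂} {E₃} {E₄} nA bf p v D₁ D₂ D₃ D₄) x∶c =
  ty-case-map (without x) nA bf p (Valid-filter _ v)
    (⊢-subst-const D₁ (x∶c ∘ case-⊆₁ G E₁ E₂ E₃ E₄ p)) (⊢-subst-const D₂ (x∶c ∘ case-⊆₂ G E₁ E₂ E₃ E₄ p))
    (⊢-subst-const D₃ (x∶c ∘ case-⊆₃ G E₁ E₂ E₃ E₄ p)) (⊢-subst-const D₄ (x∶c ∘ case-⊆₄ G E₁ E₂ E₃ E₄ p))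
⊢-subst-const {x = x} (ty-rec {Γ₁ = G₁} {G₂} {E₁} {E₂} nA bf lt p v D₁ D₂ D₃) x∶c =
  ty-rec-map (without x) {G₁ = G₁} {G₂} {E₁} {E₂} nA bf lt p (Valid-filter _ v)
    (⊢-subst-const D₁ (x∶c ∘ rec-⊆₁ G₁ G₂ E₁ E₂ p)) (⊢-subst-const D₂ (x∶c ∘ rec-⊆₂ G₁ G₂ E₁ E₂ p))
    (⊢-subst-const D₃ (x∶c ∘ rec-⊆₃ G₁ G₂ E₁ E₂ p))
⊢-subst-const {x = x} (ty-app {Γ = G} {E₁} {E₂} nA lt p v D₁ D₂) x∶c =
  ty-app-map (without x) nA lt p (Valid-filter _ v)
    (⊢-subst-const D₁ (x∶c ∘ app-⊆₁ G E₁ E₂ p)) (⊢-subst-const D₂ (x∶c ∘ app-⊆₂ G E₁ E₂ p))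

-- Substituting a term for a ■-variable whose type is not N

≤ₐ■ : ∀ a → a ≤ₐ ■
≤ₐ■ □ = □≤■
≤ₐ■ ■ = ■≤■

module LinearSubstitution {x : Name} {H : Type} (H≢N : H ≢ N) {s : Term} {Γ Ξ : Ctx}
                          (Γ∶N : AllN Γ) (Ds : Γ ++ Ξ ⊢ s ∶ H) where

  names : List Name
  names = x ∷ dom Γ

  -- For the context M = Γ, x:■H, Θ of the theorem, rest M = Θ.
  shared rest : Ctx → Ctx
  shared = restrict names
  rest   = exclude names

  shared-++ : ∀ A B → shared (A ++ B) ≡ shared A ++ shared B
  shared-++ = filter-++ (nm∈? names)

  rest-++ : ∀ A B → rest (A ++ B) ≡ rest A ++ rest B
  rest-++ = filter-++ (nm∉? names)

  rest-↭ : ∀ {M L} → M ↭ L → rest M ↭ rest L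
  rest-↭ = ↭.filter-↭ (nm∉? names)

  rest-app : ∀ {M} G E₁ E₂ → M ↭ G ++ E₁ ++ E₂ → rest M ↭ rest G ++ rest E₁ ++ rest E₂
  rest-app G E₁ E₂ p rewrite sym (rest-++ E₁ E₂) | sym (rest-++ G (E₁ ++ E₂)) = rest-↭ p

  rest-case : ∀ {M} G E₁ E₂ E₃ E₄ → M ↭ G ++ E₁ ++ E₂ ++ E₃ ++ E₄ →
              rest M ↭ rest G ++ rest E₁ ++ rest E₂ ++ rest E₃ ++ rest E₄
  rest-case G E₁ E₂ E₃ E₄ p
    rewrite sym (rest-++ E₃ E₄) | sym (rest-++ E₂ (E₃ ++ E₄)) | sym (rest-++ E₁ (E₂ ++ E₃ ++ E₄))
          | sym (rest-++ G (E₁ ++ E₂ ++ E₃ ++ E₄)) =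
    rest-↭ p

  rest-rec : ∀ {M} G₁ G₂ E₁ E₂ → M ↭ (G₁ ++ G₂) ++ (E₁ ++ E₂) →
             rest M ↭ (rest G₁ ++ rest G₂) ++ (rest E₁ ++ rest E₂)
  rest-rec G₁ G₂ E₁ E₂ p
    rewrite sym (rest-++ G₁ G₂) | sym (rest-++ E₁ E₂) | sym (rest-++ (G₁ ++ G₂) (E₁ ++ E₂)) =
    rest-↭ p

  record Fits (M : Ctx) : Set where
    field
      x∶■H       : ∀ {a B} → (x ∶[ a ] B) ∈ M → a ≡ ■ × B ≡ H
      compatible : Compatible Γ M
  open Fits

  Fits-⊆ : ∀ {M L} → Valid M → Fits M → L ⊆ M → Fits L
  Fits-⊆ vM fits L⊆M = record
    { x∶■H = x∶■H fits ∘ L⊆M ; compatible = Compatible-⊆ vM (compatible fits) L⊆M }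

  Supplies : Ctx → Ctx → Set
  Supplies M E = x ∈ dom M → ∃ λ E′ → E ↭ Ξ ++ E′

  supplies-↭ : ∀ {M L E} G → M ↭ G ++ L → Supplies M E → Supplies L E
  supplies-↭ G p sup = sup ∘ dom-⊆ (⊆.⊆-trans (⊆.xs⊆ys++xs _ G) (⊆.⊆-reflexive-↭ (↭-sym p)))

  split-supply : ∀ A B {E} → Valid (A ++ B) → Supplies (A ++ B) E →
                 ∃₂ λ F₁ F₂ → E ↭ F₁ ++ F₂ × Supplies A F₁ × Supplies B F₂
  split-supply A B {E} v sup with x ∈? dom A
  ... | yes x∈A = E , [] , ↭-sym (↭.++-identityʳ E) , (λ _ → sup (∈-dom-++⁺ˡ x∈A))
                , λ x∈B → ⊥-elim (Valid-++-disjoint A v x∈A x∈B)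
  ... | no  x∉A = [] , E , ↭-refl , (λ x∈A → ⊥-elim (x∉A x∈A)) , sup ∘ ∈-dom-++⁺ʳ A

  x∉N-part : ∀ {M G} → Fits M → G ⊆ M → AllN G → x ∉ dom G
  x∉N-part fits G⊆M G∶N x∈G with d , d∈G , refl ← ∈-dom⁻ x∈G =
    H≢N (trans (sym (proj₂ (x∶■H fits (G⊆M d∈G)))) (All.lookup G∶N d∈G))

  x∉□-part : ∀ {M G} → Fits M → G ⊆ M → G <:ₐ □ → x ∉ dom G
  x∉□-part fits G⊆M G<:□ x∈G with d , d∈G , refl ← ∈-dom⁻ x∈G
    with refl ← proj₁ (x∶■H fits (G⊆M d∈G)) with () ← All.lookup G<:□ d∈G

  shared-↭ : ∀ {L} → x ∉ dom L → Valid L → Compatible Γ L → shared L ↭ restrict (dom L) Γ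
  shared-↭ {L} x∉L vL comp =
    restrict-↭-restrict vL (Valid-++⁻ˡ Γ (⊢-valid Ds)) comp there named-in-Γ
    where
    named-in-Γ : ∀ {d} → d ∈ L → nm d ∈ names → nm d ∈ dom Γ
    named-in-Γ d∈L (here refl) = ⊥-elim (x∉L (∈-dom⁺ d∈L))
    named-in-Γ d∈L (there p)   = p

  shared-N : ∀ {L} → x ∉ dom L → Valid L → Compatible Γ L → AllN (shared L)
  shared-N x∉L vL comp = ↭.All-resp-↭ (↭-sym (shared-↭ x∉L vL comp)) (All.filter⁺ _ Γ∶N)

  split : ∀ L → L ↭ shared L ++ rest L
  split = ↭-restrict-exclude names

  Γ-split : ∀ {L} → x ∉ dom L → Valid L → Compatible Γ L → Γ ↭ shared L ++ exclude (dom L) Γ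
  Γ-split {L} x∉L vL comp =
    ↭-trans (↭-restrict-exclude (dom L) Γ) (↭.++⁺ʳ _ (↭-sym (shared-↭ x∉L vL comp)))

  split-right : ∀ G L → G ++ L ↭ (G ++ shared L) ++ rest L
  split-right G L = ↭-trans (↭.++⁺ˡ G (split L)) (↭-reflexive (sym (++-assoc G (shared L) (rest L))))

  □-app-contexts : ∀ {M} G E₁ E₂ E → x ∉ dom (G ++ E₂) → Valid (G ++ E₂) → Compatible Γ (G ++ E₂) →
    M ↭ G ++ E₁ ++ E₂ →
    let X = exclude (dom (G ++ E₂)) Γ ++ rest E₁ ++ E in
    (Γ ++ rest M ++ E ↭ (G ++ shared E₂) ++ X ++ rest E₂) × (Γ ++ rest (G ++ E₁) ++ E ↭ (G ++ shared E₂) ++ X)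
  □-app-contexts G E₁ E₂ E x∉L vL compL p =
    ↭-trans (↭.++⁺ Γ-parts (↭.++⁺ʳ E (rest-app G E₁ E₂ p)))
      (↭-trans (solve 7 (λ sg se co rg r₁ r₂ e →
                           ((sg ⊕ se) ⊕ co) ⊕ (rg ⊕ r₁ ⊕ r₂) ⊕ e ⊜ ((sg ⊕ rg) ⊕ se) ⊕ (co ⊕ r₁ ⊕ e) ⊕ r₂)
                       ↭-refl (shared G) (shared E₂) Co (rest G) (rest E₁) (rest E₂) E)
        (G-back _)) ,
    ↭-trans (↭.++⁺ Γ-parts (↭.++⁺ʳ E (↭-reflexive (rest-++ G E₁))))
      (↭-trans (solve 6 (λ sg se co rg r₁ e →
                           ((sg ⊕ se) ⊕ co) ⊕ (rg ⊕ r₁) ⊕ e ⊜ ((sg ⊕ rg) ⊕ se) ⊕ (co ⊕ r₁ ⊕ e))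
                       ↭-refl (shared G) (shared E₂) Co (rest G) (rest E₁) E)
        (G-back _))
    where
    Co : Ctx
    Co = exclude (dom (G ++ E₂)) Γ
    Γ-parts : Γ ↭ (shared G ++ shared E₂) ++ Co
    Γ-parts = ↭-trans (Γ-split x∉L vL compL) (↭-reflexive (cong (_++ Co) (shared-++ G E₂)))
    G-back : ∀ Y → ((shared G ++ rest G) ++ shared E₂) ++ Y ↭ (G ++ shared E₂) ++ Y
    G-back Y = ↭.++⁺ʳ Y (↭.++⁺ʳ (shared E₂) (↭-sym (split G)))

  rec-contexts : ∀ {M} G₁ G₂ E₁ E₂ E → x ∉ dom ((G₁ ++ G₂) ++ E₁) → Valid ((G₁ ++ G₂) ++ E₁) →
    Compatible Γ ((G₁ ++ G₂) ++ E₁) → M ↭ (G₁ ++ G₂) ++ (E₁ ++ E₂) →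
    let X = exclude (dom ((G₁ ++ G₂) ++ E₁)) Γ ++ rest E₂ ++ E in
    (Γ ++ rest M ++ E ↭ ((G₁ ++ shared E₁) ++ G₂) ++ (rest E₁ ++ X)) ×
    (Γ ++ rest ((G₁ ++ G₂) ++ E₂) ++ E ↭ ((G₁ ++ shared E₁) ++ G₂) ++ X)
  rec-contexts G₁ G₂ E₁ E₂ E x∉L vL compL p =
    ↭-trans (↭.++⁺ Γ-parts (↭.++⁺ʳ E (rest-rec G₁ G₂ E₁ E₂ p)))
      (↭-trans (solve 9 (λ s₁ s₂ se co r₁ r₂ re₁ re₂ e →
                           (((s₁ ⊕ s₂) ⊕ se) ⊕ co) ⊕ ((r₁ ⊕ r₂) ⊕ (re₁ ⊕ re₂)) ⊕ e ⊜
                           (((s₁ ⊕ r₁) ⊕ se) ⊕ (s₂ ⊕ r₂)) ⊕ (re₁ ⊕ (co ⊕ re₂ ⊕ e)))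
                       ↭-refl (shared G₁) (shared G₂) (shared E₁) Co (rest G₁) (rest G₂) (rest E₁) (rest E₂) E)
        (G-back _)) ,
    ↭-trans (↭.++⁺ Γ-parts (↭.++⁺ʳ E (↭-reflexive (trans (rest-++ (G₁ ++ G₂) E₂) (cong (_++ rest E₂) (rest-++ G₁ G₂))))))
      (↭-trans (solve 8 (λ s₁ s₂ se co r₁ r₂ re₂ e →
                           (((s₁ ⊕ s₂) ⊕ se) ⊕ co) ⊕ ((r₁ ⊕ r₂) ⊕ re₂) ⊕ e ⊜
                           (((s₁ ⊕ r₁) ⊕ se) ⊕ (s₂ ⊕ r₂)) ⊕ (co ⊕ re₂ ⊕ e))
                       ↭-refl (shared G₁) (shared G₂) (shared E₁) Co (rest G₁) (rest G₂) (rest E₂) E)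
        (G-back _))
    where
    Co : Ctx
    Co = exclude (dom ((G₁ ++ G₂) ++ E₁)) Γ
    Γ-parts : Γ ↭ ((shared G₁ ++ shared G₂) ++ shared E₁) ++ Co
    Γ-parts = ↭-trans (Γ-split x∉L vL compL)
                (↭-reflexive (cong (_++ Co) (trans (shared-++ (G₁ ++ G₂) E₁) (cong (_++ shared E₁) (shared-++ G₁ G₂)))))
    G-back : ∀ Y → (((shared G₁ ++ rest G₁) ++ shared E₁) ++ (shared G₂ ++ rest G₂)) ++ Y ↭
                   ((G₁ ++ shared E₁) ++ G₂) ++ Y
    G-back Y = ↭.++⁺ʳ Y (↭.++⁺ (↭.++⁺ʳ (shared E₁) (↭-sym (split G₁))) (↭-sym (split G₂)))

  ⊢-subst-var : ∀ {M y a A E} → Valid M → (y ∶[ a ] A) ∈ M → Fits M → Supplies M E →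
                Valid (Γ ++ rest M ++ E) → Γ ++ rest M ++ E ⊢ fvar y [ x ≔ s ] ∶ A
  ⊢-subst-var {M} {y} {a} {A} {E} vM y∈M fits sup vT with x ≟ y
  ... | yes refl with E′ , E↭ ← sup (∈-dom⁺ y∈M) =
    subst (_ ⊢ s ∶_) (sym (proj₂ (x∶■H fits y∈M))) (⊢-↭ (↭-sym q) (⊢-weaken* (rest M ++ E′) Ds (Valid-↭ q vT)))
    where
    q : Γ ++ rest M ++ E ↭ (rest M ++ E′) ++ (Γ ++ Ξ)
    q = ↭-trans (↭.++⁺ˡ Γ (↭.++⁺ˡ (rest M) E↭))
          (solve 4 (λ g r ξ e → g ⊕ r ⊕ ξ ⊕ e ⊜ (r ⊕ e) ⊕ (g ⊕ ξ)) ↭-refl Γ (rest M) Ξ E′)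
  ... | no  x≢y with nm∈? names (y ∶[ a ] A)
  ...   | no  y∉names       = ty-var vT (∈-++⁺ʳ Γ (∈-++⁺ˡ (∈-filter⁺ (nm∉? names) y∈M y∉names)))
  ...   | yes (here y≡x)    = ⊥-elim (x≢y (sym y≡x))
  ...   | yes (there y∈Γ)   = ty-var vT (∈-++⁺ˡ (Compatible-∈ vM (compatible fits) y∈M y∈Γ))

  mutual
    ⊢-subst : ∀ n {M t A E} → depth t ≤ n → M ⊢ t ∶ A → Fits M → Supplies M E →
              Valid (Γ ++ rest M ++ E) → Γ ++ rest M ++ E ⊢ t [ x ≔ s ] ∶ A
    ⊢-subst n h (ty-var v y∈M) fits sup vT = ⊢-subst-var v y∈M fits sup vT
    ⊢-subst n h (ty-sub D B<:C) fits sup vT = ty-sub (⊢-subst n h D fits sup vT) B<:C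
    ⊢-subst (suc n) (s≤s h) (ty-lam y y∉t D) fits sup vT = ⊢-subst-lam n y y∉t h D fits sup vT
    ⊢-subst n h (ty-const _) fits sup vT = ty-const vT
    ⊢-subst (suc n) {t = case B t₁ t₂ t₃ t₄} h (ty-case nA bf p v D₁ D₂ D₃ D₄) fits sup vT =
      ⊢-subst-case n nA bf p v (depth-case⁻ {B} t₁ t₂ t₃ t₄ h) D₁ D₂ D₃ D₄ fits sup vT
    ⊢-subst (suc n) {t = recursion B t u r} h (ty-rec {Γ₁ = G₁} {G₂} {E₁} {E₂} nA bf lt p v D₁ D₂ D₃) fits sup vT =
      ⊢-subst-rec n {G₁ = G₁} {G₂} {E₁} {E₂} nA bf lt p v (proj₁ (proj₂ (depth-recursion⁻ {B} t u r h))) D₁ D₂ D₃ fits sup vT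
    ⊢-subst (suc n) {t = app t u} h (ty-app {a = □} nA lt p v D₁ D₂) fits sup vT =
      ⊢-subst-app□ n nA lt p v (proj₁ (depth-app⁻ t u h)) D₁ D₂ fits sup vT
    ⊢-subst (suc n) {t = app t u} h (ty-app {a = ■} nA _ p v D₁ D₂) fits sup vT =
      ⊢-subst-app■ n nA p v (depth-app⁻ t u h) D₁ D₂ fits sup vT

    ⊢-subst-lam : ∀ n {M t a A B E} y → y ∉ fv t → depth t ≤ n → (y ∶[ a ] A) ∷ M ⊢ open-var t y ∶ B →
                Fits M → Supplies M E → Valid (Γ ++ rest M ++ E) →
                Γ ++ rest M ++ E ⊢ lam a A t [ x ≔ s ] ∶ (a ▹ A ⇒ B)
    ⊢-subst-lam n {M} {t} {a} {A} {B} {E} y y∉t h D fits sup vT =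
      ty-lam w (∉-fv-subst s t w∉t w∉s)
        (subst (d ∷ Γ ++ rest M ++ E ⊢_∶ B) (subst-open-var t x≢w (⊢-LC Ds))
          (⊢-↭ (↭.shift d Γ (rest M ++ E))
            (subst (λ R → Γ ++ R ++ E ⊢ open-var t w [ x ≔ s ] ∶ B) rest-d∷M
              (⊢-subst n (subst (_≤ n) (sym (depth-openAt 0 w t)) h)
                (⊢-rename-body {t = t} y∉t w∉t w∉M D) fits′ sup′ vT′))))
      where
      avoid : List Name
      avoid = x ∷ dom M ++ dom (Γ ++ rest M ++ E) ++ fv t ++ fv s
      w : Name
      w = fresh avoid
      d : Decl
      d = w ∶[ a ] A
      x≢w : x ≢ w
      x≢w x≡w = fresh-∉ avoid (here (sym x≡w))
      w∉M : w ∉ dom M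
      w∉M = fresh-∉ avoid ∘ there ∘ ∈-++⁺ˡ
      w∉T : w ∉ dom (Γ ++ rest M ++ E)
      w∉T = fresh-∉ avoid ∘ there ∘ ∈-++⁺ʳ (dom M) ∘ ∈-++⁺ˡ
      w∉t : w ∉ fv t
      w∉t = fresh-∉ avoid ∘ there ∘ ∈-++⁺ʳ (dom M) ∘ ∈-++⁺ʳ (dom (Γ ++ rest M ++ E)) ∘ ∈-++⁺ˡ
      w∉s : w ∉ fv s
      w∉s = fresh-∉ avoid ∘ there ∘ ∈-++⁺ʳ (dom M) ∘ ∈-++⁺ʳ (dom (Γ ++ rest M ++ E)) ∘ ∈-++⁺ʳ (fv t)
      w∉names : w ∉ names
      w∉names (here w≡x)  = x≢w (sym w≡x)
      w∉names (there w∈Γ) = w∉T (∈-dom-++⁺ˡ w∈Γ)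
      rest-d∷M : rest (d ∷ M) ≡ d ∷ rest M
      rest-d∷M = filter-accept (nm∉? names) w∉names
      fits′ : Fits (d ∷ M)
      fits′ = record
        { x∶■H       = λ { (here x≡d) → ⊥-elim (x≢w (cong nm x≡d)) ; (there m) → x∶■H fits m }
        ; compatible = λ { c∈Γ (here c≡w) → ⊥-elim (w∉T (∈-dom-++⁺ˡ (subst (_∈ dom Γ) c≡w (∈-dom⁺ c∈Γ))))
                         ; c∈Γ (there p)   → there (compatible fits c∈Γ p) }
        }
      sup′ : Supplies (d ∷ M) E
      sup′ (here x≡w) = ⊥-elim (x≢w x≡w)
      sup′ (there x∈M) = sup x∈M
      vT′ : Valid (Γ ++ rest (d ∷ M) ++ E)
      vT′ = subst (λ R → Valid (Γ ++ R ++ E)) (sym rest-d∷M)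
              (Valid-↭ (↭-sym (↭.shift d Γ (rest M ++ E))) (Valid-∷⁺ d w∉T vT))

    ⊢-subst-branch : ∀ n {G L t A F} → AllN G → depth t ≤ n → G ++ L ⊢ t ∶ A → Fits (G ++ L) →
                   Supplies L F → Valid ((Γ ++ rest G) ++ (rest L ++ F)) →
                   (Γ ++ rest G) ++ (rest L ++ F) ⊢ t [ x ≔ s ] ∶ A
    ⊢-subst-branch n {G} {L} {F = F} nA h D fits sup v =
      ⊢-↭ q (⊢-subst n h D fits sup′ (Valid-↭ (↭-sym q) v))
      where
      q : Γ ++ rest (G ++ L) ++ F ↭ (Γ ++ rest G) ++ (rest L ++ F)
      q = ↭-trans (↭-reflexive (cong (λ R → Γ ++ R ++ F) (rest-++ G L)))
            (solve 4 (λ g r l f → g ⊕ (r ⊕ l) ⊕ f ⊜ (g ⊕ r) ⊕ (l ⊕ f)) ↭-refl Γ (rest G) (rest L) F)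
      sup′ : Supplies (G ++ L) F
      sup′ x∈ with ∈-dom-++⁻ G x∈
      ... | inj₁ x∈G = ⊥-elim (x∉N-part fits (⊆.xs⊆xs++ys G L) nA x∈G)
      ... | inj₂ x∈L = sup x∈L

    ⊢-subst-case : ∀ n {M G E₁ E₂ E₃ E₄ t₁ t₂ t₃ t₄ B E} → AllN G → BoxFree B →
      M ↭ G ++ E₁ ++ E₂ ++ E₃ ++ E₄ → Valid M →
      depth t₁ ≤ n × depth t₂ ≤ n × depth t₃ ≤ n × depth t₄ ≤ n →
      G ++ E₁ ⊢ t₁ ∶ N → G ++ E₂ ⊢ t₂ ∶ B → G ++ E₃ ⊢ t₃ ∶ B → G ++ E₄ ⊢ t₄ ∶ B →
      Fits M → Supplies M E → Valid (Γ ++ rest M ++ E) →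
      Γ ++ rest M ++ E ⊢ case B t₁ t₂ t₃ t₄ [ x ≔ s ] ∶ B
    ⊢-subst-case n {M} {G} {E₁} {E₂} {E₃} {E₄} {E = E} nA bf p v (h₁ , h₂ , h₃ , h₄) D₁ D₂ D₃ D₄ fits sup vT
      with F₁ , E′ , E↭ , sup₁ , sup′ ← split-supply E₁ _ (Valid-++⁻ʳ G (Valid-↭ p v)) (supplies-↭ G p sup)
      with F₂ , E″ , E′↭ , sup₂ , sup″ ← split-supply E₂ _ (Valid-++⁻ʳ E₁ (Valid-++⁻ʳ G (Valid-↭ p v))) sup′
      with F₃ , F₄ , E″↭ , sup₃ , sup₄ ← split-supply E₃ E₄ (Valid-++⁻ʳ E₂ (Valid-++⁻ʳ E₁ (Valid-++⁻ʳ G (Valid-↭ p v)))) sup″ =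
      ty-case (All.++⁺ Γ∶N (All.filter⁺ _ nA)) bf q vT
        (⊢-subst-branch n nA h₁ D₁ (Fits-⊆ v fits (case-⊆₁ G E₁ E₂ E₃ E₄ p)) sup₁ (Valid-++-take Γ′ B₁ vq))
        (⊢-subst-branch n nA h₂ D₂ (Fits-⊆ v fits (case-⊆₂ G E₁ E₂ E₃ E₄ p)) sup₂ (Valid-++-take Γ′ B₂ vq₂))
        (⊢-subst-branch n nA h₃ D₃ (Fits-⊆ v fits (case-⊆₃ G E₁ E₂ E₃ E₄ p)) sup₃ (Valid-++-take Γ′ B₃ vq₃))
        (⊢-subst-branch n nA h₄ D₄ (Fits-⊆ v fits (case-⊆₄ G E₁ E₂ E₃ E₄ p)) sup₄ (Valid-++-drop Γ′ B₃ vq₃))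
      where
      Γ′ B₁ B₂ B₃ B₄ : Ctx
      Γ′ = Γ ++ rest G
      B₁ = rest E₁ ++ F₁
      B₂ = rest E₂ ++ F₂
      B₃ = rest E₃ ++ F₃
      B₄ = rest E₄ ++ F₄
      q : Γ ++ rest M ++ E ↭ Γ′ ++ B₁ ++ B₂ ++ B₃ ++ B₄
      q = ↭-trans (↭.++⁺ˡ Γ (↭.++⁺ (rest-case G E₁ E₂ E₃ E₄ p) (↭-trans E↭ (↭.++⁺ˡ F₁ (↭-trans E′↭ (↭.++⁺ˡ F₂ E″↭))))))
            (solve 10 (λ g r r₁ r₂ r₃ r₄ f₁ f₂ f₃ f₄ →
                         g ⊕ (r ⊕ r₁ ⊕ r₂ ⊕ r₃ ⊕ r₄) ⊕ (f₁ ⊕ f₂ ⊕ f₃ ⊕ f₄) ⊜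
                         (g ⊕ r) ⊕ (r₁ ⊕ f₁) ⊕ (r₂ ⊕ f₂) ⊕ (r₃ ⊕ f₃) ⊕ (r₄ ⊕ f₄))
                       ↭-refl Γ (rest G) (rest E₁) (rest E₂) (rest E₃) (rest E₄) F₁ F₂ F₃ F₄)
      vq  = Valid-↭ q vT
      vq₂ = Valid-++-drop Γ′ B₁ vq
      vq₃ = Valid-++-drop Γ′ B₂ vq₂

    ⊢-subst-app■ : ∀ n {M G E₁ E₂ t u A B E} → AllN G → M ↭ G ++ E₁ ++ E₂ → Valid M →
      depth t ≤ n × depth u ≤ n → G ++ E₁ ⊢ t ∶ (■ ▹ A ⇒ B) → G ++ E₂ ⊢ u ∶ A →
      Fits M → Supplies M E → Valid (Γ ++ rest M ++ E) →
      Γ ++ rest M ++ E ⊢ app t u [ x ≔ s ] ∶ B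
    ⊢-subst-app■ n {M} {G} {E₁} {E₂} {E = E} nA p v (h₁ , h₂) D₁ D₂ fits sup vT
      with F₁ , F₂ , E↭ , sup₁ , sup₂ ← split-supply E₁ E₂ (Valid-++⁻ʳ G (Valid-↭ p v)) (supplies-↭ G p sup) =
      ty-app (All.++⁺ Γ∶N (All.filter⁺ _ nA)) (All.tabulate λ {d} _ → ≤ₐ■ (asp d)) q vT
        (⊢-subst-branch n nA h₁ D₁ (Fits-⊆ v fits (app-⊆₁ G E₁ E₂ p)) sup₁ (Valid-++-take Γ′ B₁ vq))
        (⊢-subst-branch n nA h₂ D₂ (Fits-⊆ v fits (app-⊆₂ G E₁ E₂ p)) sup₂ (Valid-++-drop Γ′ B₁ vq))
      where
      Γ′ B₁ B₂ : Ctx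
      Γ′ = Γ ++ rest G
      B₁ = rest E₁ ++ F₁
      B₂ = rest E₂ ++ F₂
      q : Γ ++ rest M ++ E ↭ Γ′ ++ B₁ ++ B₂
      q = ↭-trans (↭.++⁺ˡ Γ (↭.++⁺ (rest-app G E₁ E₂ p) E↭))
            (solve 6 (λ g r r₁ r₂ f₁ f₂ → g ⊕ (r ⊕ r₁ ⊕ r₂) ⊕ (f₁ ⊕ f₂) ⊜ (g ⊕ r) ⊕ (r₁ ⊕ f₁) ⊕ (r₂ ⊕ f₂))
                   ↭-refl Γ (rest G) (rest E₁) (rest E₂) F₁ F₂)
      vq = Valid-↭ q vT

    ⊢-subst-app□ : ∀ n {M G E₁ E₂ t u A B E} → AllN G → (G ++ E₂) <:ₐ □ → M ↭ G ++ E₁ ++ E₂ → Valid M →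
      depth t ≤ n → G ++ E₁ ⊢ t ∶ (□ ▹ A ⇒ B) → G ++ E₂ ⊢ u ∶ A →
      Fits M → Supplies M E → Valid (Γ ++ rest M ++ E) →
      Γ ++ rest M ++ E ⊢ app t u [ x ≔ s ] ∶ B
    ⊢-subst-app□ n {M} {G} {E₁} {E₂} {t} {u} {A} {B} {E} nA lt p v h D₁ D₂ fits sup vT =
      ty-app (All.++⁺ nA (All.++⁻ʳ (shared G) (subst AllN (shared-++ G E₂) (shared-N x∉L vL compL))))
        (↭.All-resp-↭ (split-right G E₂) lt) q vT D₁′ D₂′
      where
      x∉L : x ∉ dom (G ++ E₂)
      x∉L = x∉□-part fits (app-⊆₂ G E₁ E₂ p) lt
      vL : Valid (G ++ E₂)
      vL = ⊢-valid D₂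
      compL : Compatible Γ (G ++ E₂)
      compL = compatible (Fits-⊆ v fits (app-⊆₂ G E₁ E₂ p))
      qs = □-app-contexts G E₁ E₂ E x∉L vL compL p
      q  = proj₁ qs
      q₁ = proj₂ qs
      D₁′ : (G ++ shared E₂) ++ _ ⊢ t [ x ≔ s ] ∶ (□ ▹ A ⇒ B)
      D₁′ = ⊢-↭ q₁ (⊢-subst n h D₁ (Fits-⊆ v fits (app-⊆₁ G E₁ E₂ p)) (sup ∘ dom-⊆ (app-⊆₁ G E₁ E₂ p))
              (Valid-↭ (↭-sym q₁) (Valid-++-take (G ++ shared E₂) _ (Valid-↭ q vT))))
      D₂′ : (G ++ shared E₂) ++ rest E₂ ⊢ u [ x ≔ s ] ∶ A
      D₂′ = subst (_ ⊢_∶ A) (sym (subst-fresh s u (x∉L ∘ fv⊆dom D₂))) (⊢-↭ (split-right G E₂) D₂)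

    ⊢-subst-rec : ∀ n {M G₁ G₂ E₁ E₂ t u r B E} → AllN (G₁ ++ G₂) → BoxFree B → (G₁ ++ E₁) <:ₐ □ →
      M ↭ (G₁ ++ G₂) ++ (E₁ ++ E₂) → Valid M → depth u ≤ n →
      G₁ ++ E₁ ⊢ t ∶ N → (G₁ ++ G₂) ++ E₂ ⊢ u ∶ B → (G₁ ++ G₂) ++ [] ⊢ r ∶ (□ ▹ N ⇒ ■ ▹ B ⇒ B) →
      Fits M → Supplies M E → Valid (Γ ++ rest M ++ E) →
      Γ ++ rest M ++ E ⊢ recursion B t u r [ x ≔ s ] ∶ B
    ⊢-subst-rec n {M} {G₁} {G₂} {E₁} {E₂} {t} {u} {r} {B} {E} nA bf lt p v h D₁ D₂ D₃ fits sup vT =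
      ty-rec {Γ₁ = G₁ ++ shared E₁} {G₂} {rest E₁} nA′ bf (↭.All-resp-↭ (split-right G₁ E₁) lt) q vT D₁′ D₂′ D₃′
      where
      L : Ctx
      L = (G₁ ++ G₂) ++ E₁
      fitsL : Fits L
      fitsL = Fits-⊆ v fits (⊆.⊆-trans (⊆.++⁺ʳ (G₁ ++ G₂) (⊆.xs⊆xs++ys E₁ E₂)) (⊆.⊆-reflexive-↭ (↭-sym p)))
      x∉G₁E₁ : x ∉ dom (G₁ ++ E₁)
      x∉G₁E₁ = x∉□-part fits (rec-⊆₁ G₁ G₂ E₁ E₂ p) lt
      x∉L : x ∉ dom L
      x∉L x∈ with ∈-dom-++⁻ (G₁ ++ G₂) x∈
      ... | inj₁ x∈G  = x∉N-part fitsL (⊆.xs⊆xs++ys _ E₁) nA x∈G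
      ... | inj₂ x∈E₁ = x∉G₁E₁ (∈-dom-++⁺ʳ G₁ x∈E₁)
      vL : Valid L
      vL = Valid-++-take (G₁ ++ G₂) E₁ (Valid-↭ p v)
      nA′ : AllN ((G₁ ++ shared E₁) ++ G₂)
      nA′ = All.++⁺ (All.++⁺ (All.++⁻ˡ G₁ nA)
                      (All.++⁻ʳ (shared (G₁ ++ G₂))
                        (subst AllN (shared-++ (G₁ ++ G₂) E₁) (shared-N x∉L vL (compatible fitsL)))))
                    (All.++⁻ʳ G₁ nA)
      qs = rec-contexts G₁ G₂ E₁ E₂ E x∉L vL (compatible fitsL) p
      q  = proj₁ qs
      q₂ = proj₂ qs
      q₃ : shared E₁ ++ (G₁ ++ G₂) ++ [] ↭ ((G₁ ++ shared E₁) ++ G₂) ++ []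
      q₃ = solve 3 (λ se g₁ g₂ → se ⊕ (g₁ ⊕ g₂) ⊕ ε ⊜ ((g₁ ⊕ se) ⊕ g₂) ⊕ ε) ↭-refl (shared E₁) G₁ G₂
      vq = Valid-↭ q vT
      D₁′ : (G₁ ++ shared E₁) ++ rest E₁ ⊢ t [ x ≔ s ] ∶ N
      D₁′ = subst (_ ⊢_∶ N) (sym (subst-fresh s t (x∉G₁E₁ ∘ fv⊆dom D₁))) (⊢-↭ (split-right G₁ E₁) D₁)
      D₂′ : ((G₁ ++ shared E₁) ++ G₂) ++ _ ⊢ u [ x ≔ s ] ∶ B
      D₂′ = ⊢-↭ q₂ (⊢-subst n h D₂ (Fits-⊆ v fits (rec-⊆₂ G₁ G₂ E₁ E₂ p)) (sup ∘ dom-⊆ (rec-⊆₂ G₁ G₂ E₁ E₂ p))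
              (Valid-↭ (↭-sym q₂) (Valid-++-drop ((G₁ ++ shared E₁) ++ G₂) (rest E₁) vq)))
      D₃′ : ((G₁ ++ shared E₁) ++ G₂) ++ [] ⊢ r [ x ≔ s ] ∶ (□ ▹ N ⇒ ■ ▹ B ⇒ B)
      D₃′ = subst (_ ⊢_∶ _) (sym (subst-fresh s r (x∉L ∘ dom-⊆ (⊆.++⁺ʳ (G₁ ++ G₂) (λ ())) ∘ fv⊆dom D₃)))
              (⊢-↭ q₃ (⊢-weaken* (shared E₁) D₃ (Valid-↭ (↭-sym q₃) (Valid-++-take _ [] vq))))

numeral-substitution : ∀ (Θ Δ : Ctx) (x : Name) (t : Term) (A : Type) (n : ℕ) →
  AllN ((x ∶[ ■ ] N) ∷ Θ) → (((x ∶[ ■ ] N) ∷ Θ) ++ Δ) ⊢ t ∶ A → (Θ ++ Δ) ⊢ t [ x ≔ const (num n) ] ∶ A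
numeral-substitution Θ Δ x t A n _ D =
  subst (_⊢ _ ∶ A) (trans (filter-reject (nm∉? (x ∷ [])) λ x∉[x] → x∉[x] (here refl)) (exclude-∉ x∉ΘΔ))
    (⊢-subst-const D x∶N)
  where
  x∉ΘΔ : x ∉ dom (Θ ++ Δ)
  x∉ΘΔ = Valid-∷⁻ (x ∶[ ■ ] N) (⊢-valid D)
  x∶N : ∀ {a B} → (x ∶[ a ] B) ∈ (x ∶[ ■ ] N) ∷ Θ ++ Δ → B ≡ N
  x∶N (here refl) = refl
  x∶N (there m)   = ⊥-elim (x∉ΘΔ (∈-dom⁺ m))

linear-substitution : ∀ (Γ Θ Ξ : Ctx) (x : Name) (H : Type) (t s : Term) (A : Type) →
  AllN Γ → H ≢ N → (Γ ++ ((x ∶[ ■ ] H) ∷ Θ)) ⊢ t ∶ A → (Γ ++ Ξ) ⊢ s ∶ H →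
  Valid (Γ ++ (Θ ++ Ξ)) → (Γ ++ (Θ ++ Ξ)) ⊢ t [ x ≔ s ] ∶ A
linear-substitution Γ Θ Ξ x H t s A Γ∶N H≢N D Ds v =
  subst (λ R → Γ ++ R ++ Ξ ⊢ t [ x ≔ s ] ∶ A) rest-M
    (⊢-subst (depth t) ≤-refl D fits (λ _ → [] , ↭-sym (↭.++-identityʳ Ξ))
      (subst (λ R → Valid (Γ ++ R ++ Ξ)) (sym rest-M) v))
  where
  open LinearSubstitution H≢N Γ∶N Ds
  d : Decl
  d = x ∶[ ■ ] H
  vM : Valid (Γ ++ d ∷ Θ)
  vM = ⊢-valid D
  x∉Θ : x ∉ dom Θ
  x∉Θ = Valid-∷⁻ d (Valid-++⁻ʳ Γ vM)
  fits : Fits (Γ ++ d ∷ Θ)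
  fits = record { x∶■H = x∶■H ; compatible = λ c∈Γ _ → ∈-++⁺ˡ c∈Γ }
    where
    x∶■H : ∀ {a B} → (x ∶[ a ] B) ∈ Γ ++ d ∷ Θ → a ≡ ■ × B ≡ H
    x∶■H m with ∈-++⁻ Γ m
    ... | inj₁ m∈Γ         = ⊥-elim (Valid-++-disjoint Γ vM (∈-dom⁺ m∈Γ) (here refl))
    ... | inj₂ (here refl) = refl , refl
    ... | inj₂ (there m∈Θ) = ⊥-elim (x∉Θ (∈-dom⁺ m∈Θ))
  rest-M : rest (Γ ++ d ∷ Θ) ≡ Θ
  rest-M = trans (filter-++ (nm∉? names) Γ (d ∷ Θ))
    (cong₂ _++_ (filter-none (nm∉? names) (All.tabulate λ c∈Γ c∉ → c∉ (there (∈-dom⁺ c∈Γ))))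
      (trans (filter-reject (nm∉? names) λ x∉ → x∉ (here refl))
        (filter-all (nm∉? names) (All.tabulate λ e∈Θ → λ
          { (here e≡x)   → x∉Θ (subst (_∈ dom Θ) e≡x (∈-dom⁺ e∈Θ))
          ; (there e∈Γ) → Valid-++-disjoint Γ vM e∈Γ (there (∈-dom⁺ e∈Θ)) }))))

mainTheorem12 :
    (∀ (Θ Δ : Ctx) (x : Name) (t : Term) (A : Type) (n : ℕ) →
      AllN ((x ∶[ ■ ] N) ∷ Θ) →
      (((x ∶[ ■ ] N) ∷ Θ) ++ Δ) ⊢ t ∶ A →
      (Θ ++ Δ) ⊢ t [ x ≔ const (num n) ] ∶ A)
    ×
    (∀ (Γ Θ Ξ : Ctx) (x : Name) (H : Type) (t s : Term) (A : Type) →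
      AllN Γ → H ≢ N →
      (Γ ++ ((x ∶[ ■ ] H) ∷ Θ)) ⊢ t ∶ A →
      (Γ ++ Ξ) ⊢ s ∶ H →
      Valid (Γ ++ (Θ ++ Ξ)) →
      (Γ ++ (Θ ++ Ξ)) ⊢ t [ x ≔ s ] ∶ A)
mainTheorem12 = numeral-substitution , linear-substitution
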